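{- For $w\in S_n$ we have $\operatorname{cc}\big(\tilde{Q}(w)\big)=\sum_{i\in\operatorname{Dsl}(w)}i$. Moreover, if $w_+\in S_{n+1}$ is the permutation agreeing with $w$ on $\mathbb{N}_n$ and fixing $n+1$, then $\operatorname{cc}\big(\tilde{Q}(w_+)\big)=\operatorname{cc}\big(\tilde{Q}(w)\big)$.
   Context: $\mathbb{N}_m=\{1,\dots,m\}$; for $w\in S_n$, $w_i=w(i)$ and $\operatorname{Dsl}(w)=\{i\in\mathbb{N}_{n-1}:w_{i+1}<w_i\}$. Tableaux are in English notation. $Q(w)$ is the recording tableau of Robinson–Schensted row insertion of $w_1,\dots,w_n$, and $\tilde{Q}(w)=\operatorname{ev}Q(w)$, where $\operatorname{ev}$ is Schützenberger's evacuation on standard Young tableaux. For a standard Young tableau $S$ with entries $\mathbb{N}_n$, with $R_S(i),C_S(i)$ the row and column of $i$, $\operatorname{Dsi}(S)$ is the set of $i\in\mathbb{N}_{n-1}$ with $R_S(i+1)>R_S(i)$ and $C_S(i+1)\le C_S(i)$; $\operatorname{ct}(S)$ is obtained from $S$ by replacing each entry $p$ by $|\{j\in\operatorname{Dsi}(S):j<p\}|$, and $\operatorname{cc}(S)$ is the sum of the entries of $\operatorname{ct}(S)$. -}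

module Defs where

open import Data.Nat using (ℕ; zero; suc; _+_; _<ᵇ_; _≡ᵇ_)
open import Data.Bool using (Bool; true; false; _∧_; if_then_else_; not)
open import Data.Nat.ListAction using (sum)
open import Data.List using (List; []; _∷_; _++_; map; length; allFin; filter; upTo; foldl)
open import Data.Maybe using (Maybe; just; nothing)
open import Data.Product using (_×_; _,_; proj₁; proj₂)
open import Data.Fin using (Fin; toℕ)
open import Data.Fin.Permutation using (Permutation′; _⟨$⟩ʳ_)

-- A tableau (English notation) is the list of its rows, top row first.
-- Rows and columns are indexed from 0 internally.
Tableau : Set
Tableau = List (List ℕ)

word : ∀ {n} → Permutation′ n → List ℕ
word {n} w = map (λ i → suc (toℕ (w ⟨$⟩ʳ i))) (allFin n)

dslFrom : ℕ → List ℕ → List ℕ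
dslFrom i []           = []
dslFrom i (x ∷ [])     = []
dslFrom i (x ∷ y ∷ xs) = if y <ᵇ x then i ∷ dslFrom (suc i) (y ∷ xs)
                                    else dslFrom (suc i) (y ∷ xs)

Dsl : ∀ {n} → Permutation′ n → List ℕ
Dsl w = dslFrom 1 (word w)

insertRow : ℕ → List ℕ → Maybe ℕ × List ℕ
insertRow x []       = nothing , x ∷ []
insertRow x (y ∷ ys) with x <ᵇ y
... | true  = just y , x ∷ ys
... | false with insertRow x ys
...   | (b , ys′) = b , y ∷ ys′

rowInsert : ℕ → Tableau → Tableau × ℕ
rowInsert x []         = ((x ∷ []) ∷ []) , 0
rowInsert x (r ∷ rs) with insertRow x r
... | (nothing , r′) = (r′ ∷ rs) , 0
... | (just y  , r′) with rowInsert y rs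
...   | (rs′ , k) = (r′ ∷ rs′) , suc k

appendAt : ℕ → ℕ → Tableau → Tableau
appendAt zero    v []       = (v ∷ []) ∷ []
appendAt zero    v (r ∷ rs) = (r ++ (v ∷ [])) ∷ rs
appendAt (suc k) v []       = (v ∷ []) ∷ []
appendAt (suc k) v (r ∷ rs) = r ∷ appendAt k v rs

rsFrom : ℕ → List ℕ → Tableau × Tableau → Tableau × Tableau
rsFrom i []       PQ = PQ
rsFrom i (x ∷ xs) (P , Q) with rowInsert x P
... | (P′ , k) = rsFrom (suc i) xs (P′ , appendAt k i Q)

RS : List ℕ → Tableau × Tableau
RS xs = rsFrom 1 xs ([] , [])

Q : ∀ {n} → Permutation′ n → Tableau
Q w = proj₂ (RS (word w))

size : Tableau → ℕ
size T = sum (map length T)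

getL : ℕ → List ℕ → Maybe ℕ
getL _       []       = nothing
getL zero    (x ∷ xs) = just x
getL (suc c) (x ∷ xs) = getL c xs

get : ℕ → ℕ → Tableau → Maybe ℕ
get _       c []       = nothing
get zero    c (r ∷ rs) = getL c r
get (suc k) c (r ∷ rs) = get k c rs

setL : ℕ → ℕ → List ℕ → List ℕ
setL _       v []       = []
setL zero    v (x ∷ xs) = v ∷ xs
setL (suc c) v (x ∷ xs) = x ∷ setL c v xs

set : ℕ → ℕ → ℕ → Tableau → Tableau
set _       c v []       = []
set zero    c v (r ∷ rs) = setL c v r ∷ rs
set (suc k) c v (r ∷ rs) = r ∷ set k c v rs

-- delete the cell in column c of a row (used only on the last cell of a row)
delL : ℕ → List ℕ → List ℕ
delL _       []       = []
delL zero    (x ∷ xs) = xs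
delL (suc c) (x ∷ xs) = x ∷ delL c xs

nonEmpty : List ℕ → Bool
nonEmpty []      = false
nonEmpty (_ ∷ _) = true

del : ℕ → ℕ → Tableau → Tableau
del r c T = filter (λ row → Data.Bool.T? (nonEmpty row)) (go r T)
  where
  go : ℕ → Tableau → Tableau
  go _       []       = []
  go zero    (x ∷ xs) = delL c x ∷ xs
  go (suc k) (x ∷ xs) = x ∷ go k xs

-- jeu de taquin slide of the empty cell at (r , c) towards the outside;
-- returns the resulting tableau and the cell that is vacated at the end.
-- (fuel: a slide path has at most size T steps)
slide : ℕ → ℕ → ℕ → Tableau → Tableau × (ℕ × ℕ)
slide zero       r c T = del r c T , (r , c)
slide (suc fuel) r c T with get r (suc c) T | get (suc r) c T
... | nothing | nothing = del r c T , (r , c)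
... | just a  | nothing = slide fuel r (suc c) (set r c a T)
... | nothing | just b  = slide fuel (suc r) c (set r c b T)
... | just a  | just b  =
  if a <ᵇ b then slide fuel r (suc c) (set r c a T)
            else slide fuel (suc r) c (set r c b T)

-- evacuation loop: k = number of remaining entries; at each step remove
-- the smallest entry (at (0,0)), slide, and label the vacated cell by k
-- in the result tableau E (which has the shape of the original tableau).
evLoop : ℕ → Tableau → Tableau → Tableau
evLoop zero    T E = E
evLoop (suc k) T E with slide (size T) 0 0 T
... | (T′ , (r , c)) = evLoop k T′ (set r c (suc k) E)

ev : Tableau → Tableau
ev T = evLoop (size T) T (map (map (λ _ → 0)) T)

Q̃ : ∀ {n} → Permutation′ n → Tableau
Q̃ w = ev (Q w)

posL : ℕ → ℕ → List ℕ → Maybe ℕ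
posL p c []       = nothing
posL p c (x ∷ xs) = if p ≡ᵇ x then just c else posL p (suc c) xs

posFrom : ℕ → ℕ → Tableau → Maybe (ℕ × ℕ)
posFrom p r []       = nothing
posFrom p r (x ∷ xs) with posL p 0 x
... | just c  = just (r , c)
... | nothing = posFrom p (suc r) xs

pos : ℕ → Tableau → Maybe (ℕ × ℕ)
pos p S = posFrom p 0 S

isDsi : Tableau → ℕ → Bool
isDsi S i with pos i S | pos (suc i) S
... | just (r , c) | just (r′ , c′) = (r <ᵇ r′) ∧ not (c <ᵇ c′)
... | _            | _              = false

Dsi : Tableau → List ℕ
Dsi S = filter (λ i → Data.Bool.T? (isDsi S i)) (map suc (upTo (size S ∸′ 1)))
  where
  _∸′_ : ℕ → ℕ → ℕ
  m ∸′ n = Data.Nat._∸_ m n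

ct : Tableau → Tableau
ct S = map (map (λ p → length (filter (λ j → Data.Bool.T? (j <ᵇ p)) (Dsi S)))) S

cc : Tableau → ℕ
cc S = sum (map sum (ct S))

{-# OPTIONS --safe #-}
-- Encode a standard tableau by its row word: the rows in which its entries were added,
-- newest first.  Inserting x and then y creates a cell strictly below and weakly left of
-- the previous one if y < x, and strictly right and weakly above it otherwise (row
-- bumping), so the descents of w are the descents of Q(w).  A jeu de taquin slide acts on
-- row words through Schützenberger's Δ, and Δ carries the cells of consecutive entries
-- i+1, i+2 to those of i, i+1 without changing whether they form a descent.  Following
-- the cells vacated during evacuation, i ∈ Dsi(ev Q(w)) iff n − i ∈ Dsl(w).  As entry p of
-- ct(S) counts the j ∈ Dsi(S) below p, cc(S) = Σ_{j ∈ Dsi(S)} (n − j) = Σ_{i ∈ Dsl(w)} i.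
-- Appending the fixed point n + 1 to w creates no descent.
module Submission where

open import Defs
open import Data.Nat
open import Data.Nat.Properties
open import Data.Nat.ListAction using (sum)
open import Data.List using (List; []; _∷_; _++_; length; map; filter; upTo; applyUpTo; tabulate; allFin)
import Data.List.Properties as List
open import Data.List.Relation.Unary.All as All using (All; []; _∷_)
open import Data.List.Relation.Unary.All.Properties using (all-filter)
open import Data.List.Relation.Unary.AllPairs using (AllPairs; []; _∷_)
open import Data.Maybe as Maybe using (Maybe; just; nothing)
open import Data.Maybe.Properties using (just-injective)
open import Data.Product using (Σ; _×_; _,_; proj₁; proj₂)
open import Data.Product.Properties using (≡-dec)
open import Data.Bool using (Bool; true; false; T; T?; _∧_; not; if_then_else_)
open import Data.Sum using (_⊎_; inj₁; inj₂; [_,_]′)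
open import Data.Empty using (⊥; ⊥-elim)
open import Data.Unit using (⊤; tt)
open import Data.Fin as Fin using (Fin; toℕ; inject₁; fromℕ)
open import Data.Fin.Properties using (toℕ-inject₁; toℕ-fromℕ; toℕ<n)
open import Data.Fin.Permutation using (Permutation′; _⟨$⟩ʳ_)
open import Relation.Binary.PropositionalEquality
open ≡-Reasoning
open import Relation.Nullary
open import Algebra.Properties.CommutativeSemigroup +-commutativeSemigroup using
  (xy∙z≈zy∙x; xy∙z≈xz∙y; interchange)

<⇒<ᵇ≡true : ∀ {m n} → m < n → (m <ᵇ n) ≡ true
<⇒<ᵇ≡true {m} {n} p with m <ᵇ n | <⇒<ᵇ p
... | true | _ = refl

≥⇒<ᵇ≡false : ∀ {m n} → n ≤ m → (m <ᵇ n) ≡ false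
≥⇒<ᵇ≡false {m} {n} p with m <ᵇ n in e
... | false = refl
... | true = ⊥-elim (<⇒≱ (<ᵇ⇒< m n (subst T (sym e) tt)) p)

≡ᵇ-refl : ∀ p → (p ≡ᵇ p) ≡ true
≡ᵇ-refl zero = refl
≡ᵇ-refl (suc p) = ≡ᵇ-refl p

≢⇒≡ᵇ≡false : ∀ p x → p ≢ x → (p ≡ᵇ x) ≡ false
≢⇒≡ᵇ≡false p x ne with p ≡ᵇ x in e
... | false = refl
... | true = ⊥-elim (ne (≡ᵇ⇒≡ p x (subst T (sym e) tt)))

m∸n≡1+m∸1+n : ∀ n i → suc i ≤ n → n ∸ i ≡ suc (n ∸ suc i)
m∸n≡1+m∸1+n (suc n) i (s≤s le) = +-∸-assoc 1 le

m∸[1+m∸[1+n]]≡n : ∀ m u → u < m → m ∸ suc (m ∸ suc u) ≡ u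
m∸[1+m∸[1+n]]≡n m u lt = trans (sym (pred[m∸n]≡m∸[1+n] m (m ∸ suc u))) (cong pred (m∸[m∸n]≡n lt))

NonEmptyRow : List ℕ → Set
NonEmptyRow row = T (nonEmpty row)

NoEmptyRows : Tableau → Set
NoEmptyRows = All NonEmptyRow

rowLength : ℕ → Tableau → ℕ
rowLength _ [] = 0
rowLength zero (r ∷ rs) = length r
rowLength (suc i) (r ∷ rs) = rowLength i rs

getL-just⇒< : ∀ c xs {v} → getL c xs ≡ just v → c < length xs
getL-just⇒< c [] ()
getL-just⇒< zero (x ∷ xs) e = s≤s z≤n
getL-just⇒< (suc c) (x ∷ xs) e = s≤s (getL-just⇒< c xs e)

getL-≥⇒nothing : ∀ c xs → length xs ≤ c → getL c xs ≡ nothing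
getL-≥⇒nothing c [] _ = refl
getL-≥⇒nothing zero (x ∷ xs) ()
getL-≥⇒nothing (suc c) (x ∷ xs) (s≤s le) = getL-≥⇒nothing c xs le

getL-<⇒just : ∀ c xs → c < length xs → Σ ℕ (λ v → getL c xs ≡ just v)
getL-<⇒just c [] ()
getL-<⇒just zero (x ∷ xs) _ = x , refl
getL-<⇒just (suc c) (x ∷ xs) (s≤s lt) = getL-<⇒just c xs lt

get-just⇒< : ∀ r c T {v} → get r c T ≡ just v → c < rowLength r T
get-just⇒< r c [] ()
get-just⇒< zero c (x ∷ T) e = getL-just⇒< c x e
get-just⇒< (suc r) c (x ∷ T) e = get-just⇒< r c T e

get-≥⇒nothing : ∀ r c T → rowLength r T ≤ c → get r c T ≡ nothing
get-≥⇒nothing r c [] _ = refl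
get-≥⇒nothing zero c (x ∷ T) le = getL-≥⇒nothing c x le
get-≥⇒nothing (suc r) c (x ∷ T) le = get-≥⇒nothing r c T le

get-<⇒just : ∀ r c T → c < rowLength r T → Σ ℕ (λ v → get r c T ≡ just v)
get-<⇒just r c [] ()
get-<⇒just zero c (x ∷ T) lt = getL-<⇒just c x lt
get-<⇒just (suc r) c (x ∷ T) lt = get-<⇒just r c T lt

get-nothing⇒≥ : ∀ r c T → get r c T ≡ nothing → rowLength r T ≤ c
get-nothing⇒≥ r c T e with c <? rowLength r T
... | yes lt with get-<⇒just r c T lt
...   | v , e2 with trans (sym e) e2
...     | ()
get-nothing⇒≥ r c T e | no nlt = ≮⇒≥ nlt

length-setL : ∀ c v xs → length (setL c v xs) ≡ length xs
length-setL c v [] = refl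
length-setL zero v (x ∷ xs) = refl
length-setL (suc c) v (x ∷ xs) = cong suc (length-setL c v xs)

getL-setL-≡ : ∀ c v xs → c < length xs → getL c (setL c v xs) ≡ just v
getL-setL-≡ c v [] ()
getL-setL-≡ zero v (x ∷ xs) _ = refl
getL-setL-≡ (suc c) v (x ∷ xs) (s≤s lt) = getL-setL-≡ c v xs lt

getL-setL-≢ : ∀ c c' v xs → c' ≢ c → getL c' (setL c v xs) ≡ getL c' xs
getL-setL-≢ c c' v [] ne = refl
getL-setL-≢ zero zero v (x ∷ xs) ne = ⊥-elim (ne refl)
getL-setL-≢ zero (suc c') v (x ∷ xs) ne = refl
getL-setL-≢ (suc c) zero v (x ∷ xs) ne = refl
getL-setL-≢ (suc c) (suc c') v (x ∷ xs) ne = getL-setL-≢ c c' v xs (λ e → ne (cong suc e))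

rowLength-set : ∀ r c v T r' → rowLength r' (set r c v T) ≡ rowLength r' T
rowLength-set r c v [] r' = refl
rowLength-set zero c v (x ∷ T) zero = length-setL c v x
rowLength-set zero c v (x ∷ T) (suc r') = refl
rowLength-set (suc r) c v (x ∷ T) zero = refl
rowLength-set (suc r) c v (x ∷ T) (suc r') = rowLength-set r c v T r'

get-set-≡ : ∀ r c v T → c < rowLength r T → get r c (set r c v T) ≡ just v
get-set-≡ r c v [] ()
get-set-≡ zero c v (x ∷ T) lt = getL-setL-≡ c v x lt
get-set-≡ (suc r) c v (x ∷ T) lt = get-set-≡ r c v T lt

get-set-≢ : ∀ r c v T r' c' → (r' , c') ≢ (r , c) → get r' c' (set r c v T) ≡ get r' c' T
get-set-≢ r c v [] r' c' ne = refl
get-set-≢ zero c v (x ∷ T) zero c' ne = getL-setL-≢ c c' v x (λ e → ne (cong (0 ,_) e))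
get-set-≢ zero c v (x ∷ T) (suc r') c' ne = refl
get-set-≢ (suc r) c v (x ∷ T) zero c' ne = refl
get-set-≢ (suc r) c v (x ∷ T) (suc r') c' ne =
  get-set-≢ r c v T r' c' (λ e → ne (cong (λ p → suc (proj₁ p) , proj₂ p) e))

nonEmpty-setL : ∀ c v xs → NonEmptyRow xs → NonEmptyRow (setL c v xs)
nonEmpty-setL c v (x ∷ xs) _ with c
... | zero = tt
... | suc c' = tt

noEmptyRows-set : ∀ r c v T → NoEmptyRows T → NoEmptyRows (set r c v T)
noEmptyRows-set r c v [] ne = []
noEmptyRows-set zero c v (x ∷ T) (p ∷ ps) = nonEmpty-setL c v x p ∷ ps
noEmptyRows-set (suc r) c v (x ∷ T) (p ∷ ps) = p ∷ noEmptyRows-set r c v T ps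

size-set : ∀ r c v T → size (set r c v T) ≡ size T
size-set r c v [] = refl
size-set zero c v (x ∷ T) = cong (_+ size T) (length-setL c v x)
size-set (suc r) c v (x ∷ T) = cong (length x +_) (size-set r c v T)

get-set-nothing : ∀ r c v T r' c' → get r' c' T ≡ nothing → get r' c' (set r c v T) ≡ nothing
get-set-nothing r c v T r' c' e =
  get-≥⇒nothing r' c' (set r c v T) (subst (_≤ c') (sym (rowLength-set r c v T r')) (get-nothing⇒≥ r' c' T e))

getL-snoc-≡ : ∀ xs m → getL (length xs) (xs ++ m ∷ []) ≡ just m
getL-snoc-≡ [] m = refl
getL-snoc-≡ (x ∷ xs) m = getL-snoc-≡ xs m

getL-snoc-≢ : ∀ xs m c → c ≢ length xs → getL c (xs ++ m ∷ []) ≡ getL c xs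
getL-snoc-≢ [] m zero ne = ⊥-elim (ne refl)
getL-snoc-≢ [] m (suc c) ne = refl
getL-snoc-≢ (x ∷ xs) m zero ne = refl
getL-snoc-≢ (x ∷ xs) m (suc c) ne = getL-snoc-≢ xs m c (λ e → ne (cong suc e))

length-snoc : ∀ (xs : List ℕ) m → length (xs ++ m ∷ []) ≡ suc (length xs)
length-snoc [] m = refl
length-snoc (x ∷ xs) m = cong suc (length-snoc xs m)

get-appendAt-≡ : ∀ k m U → k ≤ length U → get k (rowLength k U) (appendAt k m U) ≡ just m
get-appendAt-≡ zero m [] _ = refl
get-appendAt-≡ zero m (x ∷ U) _ = getL-snoc-≡ x m
get-appendAt-≡ (suc k) m [] ()
get-appendAt-≡ (suc k) m (x ∷ U) (s≤s le) = get-appendAt-≡ k m U le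

get-appendAt-≢ : ∀ k m U r c → k ≤ length U → (r , c) ≢ (k , rowLength k U) →
  get r c (appendAt k m U) ≡ get r c U
get-appendAt-≢ zero m [] zero zero le ne = ⊥-elim (ne refl)
get-appendAt-≢ zero m [] zero (suc c) le ne = refl
get-appendAt-≢ zero m [] (suc r) c le ne = refl
get-appendAt-≢ zero m (x ∷ U) zero c le ne = getL-snoc-≢ x m c (λ e → ne (cong (0 ,_) e))
get-appendAt-≢ zero m (x ∷ U) (suc r) c le ne = refl
get-appendAt-≢ (suc k) m [] r c () ne
get-appendAt-≢ (suc k) m (x ∷ U) zero c le ne = refl
get-appendAt-≢ (suc k) m (x ∷ U) (suc r) c (s≤s le) ne =
  get-appendAt-≢ k m U r c le (λ e → ne (cong (λ p → suc (proj₁ p) , proj₂ p) e))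

rowLength-appendAt-≡ : ∀ k m U → k ≤ length U → rowLength k (appendAt k m U) ≡ suc (rowLength k U)
rowLength-appendAt-≡ zero m [] _ = refl
rowLength-appendAt-≡ zero m (x ∷ U) _ = length-snoc x m
rowLength-appendAt-≡ (suc k) m [] ()
rowLength-appendAt-≡ (suc k) m (x ∷ U) (s≤s le) = rowLength-appendAt-≡ k m U le

rowLength-appendAt-≢ : ∀ k m U r → k ≤ length U → r ≢ k → rowLength r (appendAt k m U) ≡ rowLength r U
rowLength-appendAt-≢ zero m [] zero le ne = ⊥-elim (ne refl)
rowLength-appendAt-≢ zero m [] (suc r) le ne = refl
rowLength-appendAt-≢ zero m (x ∷ U) zero le ne = ⊥-elim (ne refl)
rowLength-appendAt-≢ zero m (x ∷ U) (suc r) le ne = refl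
rowLength-appendAt-≢ (suc k) m [] r () ne
rowLength-appendAt-≢ (suc k) m (x ∷ U) zero le ne = refl
rowLength-appendAt-≢ (suc k) m (x ∷ U) (suc r) (s≤s le) ne =
  rowLength-appendAt-≢ k m U r le (λ e → ne (cong suc e))

size-appendAt : ∀ k m U → size (appendAt k m U) ≡ suc (size U)
size-appendAt zero m [] = refl
size-appendAt zero m (x ∷ U) = cong (_+ size U) (length-snoc x m)
size-appendAt (suc k) m [] = refl
size-appendAt (suc k) m (x ∷ U) = trans (cong (length x +_) (size-appendAt k m U)) (+-suc (length x) (size U))

nonEmpty-snoc : ∀ xs m → NonEmptyRow (xs ++ m ∷ [])
nonEmpty-snoc [] m = tt
nonEmpty-snoc (x ∷ xs) m = tt

noEmptyRows-appendAt : ∀ k m U → NoEmptyRows U → NoEmptyRows (appendAt k m U)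
noEmptyRows-appendAt zero m [] _ = tt ∷ []
noEmptyRows-appendAt zero m (x ∷ U) (p ∷ ps) = nonEmpty-snoc x m ∷ ps
noEmptyRows-appendAt (suc k) m [] _ = tt ∷ []
noEmptyRows-appendAt (suc k) m (x ∷ U) (p ∷ ps) = p ∷ noEmptyRows-appendAt k m U ps

rowLength-pos⇒< : ∀ r T → 0 < rowLength r T → r < length T
rowLength-pos⇒< r [] ()
rowLength-pos⇒< zero (x ∷ T) _ = s≤s z≤n
rowLength-pos⇒< (suc r) (x ∷ T) p = s≤s (rowLength-pos⇒< r T p)

row+column<size : ∀ r c T → NoEmptyRows T → c < rowLength r T → r + c < size T
row+column<size r c [] ne ()
row+column<size zero c (x ∷ T) ne lt = ≤-trans lt (m≤m+n (length x) (size T))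
row+column<size (suc r) c ([] ∷ T) (() ∷ ps) lt
row+column<size (suc r) c ((y ∷ ys) ∷ T) (p ∷ ps) lt =
  s≤s (≤-trans (row+column<size r c T ps lt) (m≤n+m (size T) (length ys)))

getL-delL-≢ : ∀ c xs c' → length xs ≡ suc c → c' ≢ c → getL c' (delL c xs) ≡ getL c' xs
getL-delL-≢ c [] c' () ne
getL-delL-≢ zero (x ∷ []) zero e ne = ⊥-elim (ne refl)
getL-delL-≢ zero (x ∷ []) (suc c') e ne = refl
getL-delL-≢ zero (x ∷ y ∷ xs) c' () ne
getL-delL-≢ (suc c) (x ∷ xs) zero e ne = refl
getL-delL-≢ (suc c) (x ∷ xs) (suc c') e ne = getL-delL-≢ c xs c' (suc-injective e) (λ q → ne (cong suc q))

getL-delL-≡ : ∀ c xs → length xs ≡ suc c → getL c (delL c xs) ≡ nothing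
getL-delL-≡ c [] ()
getL-delL-≡ zero (x ∷ []) e = refl
getL-delL-≡ zero (x ∷ y ∷ xs) ()
getL-delL-≡ (suc c) (x ∷ xs) e = getL-delL-≡ c xs (suc-injective e)

noEmptyRows-del : ∀ r c T → NoEmptyRows (del r c T)
noEmptyRows-del zero c [] = []
noEmptyRows-del (suc r) c [] = []
noEmptyRows-del zero c (x ∷ T) = all-filter (λ row → T? (nonEmpty row)) (delL c x ∷ T)
noEmptyRows-del (suc r) c ([] ∷ T) = noEmptyRows-del r c T
noEmptyRows-del (suc r) c ((y ∷ ys) ∷ T) = tt ∷ noEmptyRows-del r c T

data Removable : ℕ → ℕ → Tableau → Set where
  only-cell : ∀ y → Removable zero zero ((y ∷ []) ∷ [])
  row0-last : ∀ c a b xs T → length xs ≡ c → Removable zero (suc c) ((a ∷ b ∷ xs) ∷ T)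
  lower-row : ∀ r c y ys T → Removable r c T → Removable (suc r) c ((y ∷ ys) ∷ T)

removable : ∀ r c T → NoEmptyRows T → rowLength r T ≡ suc c → (c ≡ 0 → rowLength (suc r) T ≡ 0) →
  Removable r c T
removable r c [] ne () h
removable zero zero ((y ∷ []) ∷ []) ne e h = only-cell y
removable zero zero ((y ∷ []) ∷ (x ∷ T)) (_ ∷ p ∷ ps) e h with x | p | h refl
... | [] | () | _
... | z ∷ zs | _ | ()
removable zero zero ((y ∷ y2 ∷ ys) ∷ T) ne () h
removable zero zero ([] ∷ T) ne () h
removable zero (suc c) ([] ∷ T) ne () h
removable zero (suc c) ((a ∷ []) ∷ T) ne (()) h
removable zero (suc c) ((a ∷ b ∷ xs) ∷ T) ne e h = row0-last c a b xs T (suc-injective (suc-injective e))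
removable (suc r) c ([] ∷ T) (() ∷ ps) e h
removable (suc r) c ((y ∷ ys) ∷ T) (p ∷ ps) e h = lower-row r c y ys T (removable r c T ps e h)

get-del-≢ : ∀ r c T → NoEmptyRows T → Removable r c T → ∀ r' c' → (r' , c') ≢ (r , c) →
  get r' c' (del r c T) ≡ get r' c' T
get-del-≢ .0 .0 .((y ∷ []) ∷ []) ne (only-cell y) zero zero n = ⊥-elim (n refl)
get-del-≢ .0 .0 .((y ∷ []) ∷ []) ne (only-cell y) zero (suc c') n = refl
get-del-≢ .0 .0 .((y ∷ []) ∷ []) ne (only-cell y) (suc r') c' n = refl
get-del-≢ .0 .(suc c) .((a ∷ b ∷ xs) ∷ T) (p ∷ ps) (row0-last c a b xs T e) zero c' n
  = getL-delL-≢ (suc c) (a ∷ b ∷ xs) c' (cong (λ q → suc (suc q)) e) (λ q → n (cong (0 ,_) q))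
get-del-≢ .0 .(suc c) .((a ∷ b ∷ xs) ∷ T) (p ∷ ps) (row0-last c a b xs T e) (suc r') c' n
  rewrite List.filter-all (λ row → T? (nonEmpty row)) ps = refl
get-del-≢ .(suc r) c .((y ∷ ys) ∷ T) (p ∷ ps) (lower-row r .c y ys T d) zero c' n = refl
get-del-≢ .(suc r) c .((y ∷ ys) ∷ T) (p ∷ ps) (lower-row r .c y ys T d) (suc r') c' n =
  get-del-≢ r c T ps d r' c' (λ q → n (cong (λ t → suc (proj₁ t) , proj₂ t) q))

get-del-≡ : ∀ r c T → NoEmptyRows T → Removable r c T → get r c (del r c T) ≡ nothing
get-del-≡ .0 .0 .((y ∷ []) ∷ []) ne (only-cell y) = refl
get-del-≡ .0 .(suc c) .((a ∷ b ∷ xs) ∷ T) (p ∷ ps) (row0-last c a b xs T e) =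
  getL-delL-≡ (suc c) (a ∷ b ∷ xs) (cong (λ q → suc (suc q)) e)
get-del-≡ .(suc r) c .((y ∷ ys) ∷ T) (p ∷ ps) (lower-row r .c y ys T d) = get-del-≡ r c T ps d

getL-ext : ∀ (xs ys : List ℕ) → (∀ c → getL c xs ≡ getL c ys) → xs ≡ ys
getL-ext [] [] h = refl
getL-ext [] (y ∷ ys) h with h 0
... | ()
getL-ext (x ∷ xs) [] h with h 0
... | ()
getL-ext (x ∷ xs) (y ∷ ys) h with h 0
... | refl = cong (x ∷_) (getL-ext xs ys (λ c → h (suc c)))

get-ext : ∀ T T' → NoEmptyRows T → NoEmptyRows T' → (∀ r c → get r c T ≡ get r c T') → T ≡ T'
get-ext [] [] _ _ h = refl
get-ext [] ([] ∷ T') _ (() ∷ _) h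
get-ext [] ((y ∷ ys) ∷ T') _ _ h with h 0 0
... | ()
get-ext ([] ∷ T) T' (() ∷ _) _ h
get-ext ((y ∷ ys) ∷ T) [] _ _ h with h 0 0
... | ()
get-ext (x ∷ T) (x' ∷ T') (p ∷ ps) (p' ∷ ps') h =
  cong₂ _∷_ (getL-ext x x' (λ c → h 0 c)) (get-ext T T' ps ps' (λ r c → h (suc r) c))

Cell : Set
Cell = ℕ × ℕ

_≟ᶜ_ : (x y : Cell) → Dec (x ≡ y)
_≟ᶜ_ = ≡-dec _≟_ _≟_

get-set-just : ∀ r c a T r' c' v → get r' c' (set r c a T) ≡ just v → (v ≡ a) ⊎ (get r' c' T ≡ just v)
get-set-just r c a T r' c' v e with (r' , c') ≟ᶜ (r , c)
... | no ne = inj₂ (trans (sym (get-set-≢ r c a T r' c' ne)) e)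
... | yes refl with c <? rowLength r T
...   | yes lt = inj₁ (just-injective (trans (sym e) (get-set-≡ r c a T lt)))
...   | no nlt with trans (sym (get-set-nothing r c a T r c (get-≥⇒nothing r c T (≮⇒≥ nlt)))) e
...     | ()

inside⇒≢hole : ∀ U zr zc r c → get zr zc U ≡ nothing → c < rowLength r U → (r , c) ≢ (zr , zc)
inside⇒≢hole U zr zc r c zn lt refl with get-<⇒just r c U lt
... | v , ev with trans (sym zn) ev
...   | ()

just-nothing⇒≢ : ∀ U r c r' c' {a} → get r c U ≡ just a → get r' c' U ≡ nothing → (r , c) ≢ (r' , c')
just-nothing⇒≢ U r c r' c' e1 e2 refl with trans (sym e1) e2
... | ()

posL-absent : ∀ p c0 xs → (∀ c → getL c xs ≢ just p) → posL p c0 xs ≡ nothing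
posL-absent p c0 [] h = refl
posL-absent p c0 (x ∷ xs) h rewrite ≢⇒≡ᵇ≡false p x (λ e → h 0 (cong just (sym e))) =
  posL-absent p (suc c0) xs (λ c → h (suc c))

posL-unique : ∀ p c0 xs c → getL c xs ≡ just p → (∀ c' → getL c' xs ≡ just p → c' ≡ c) →
  posL p c0 xs ≡ just (c0 + c)
posL-unique p c0 [] c () u
posL-unique p c0 (x ∷ xs) zero refl u rewrite ≡ᵇ-refl x = cong just (sym (+-identityʳ c0))
posL-unique p c0 (x ∷ xs) (suc c) e u with p ≟ x
... | yes refl with u 0 refl
...   | ()
posL-unique p c0 (x ∷ xs) (suc c) e u | no ne rewrite ≢⇒≡ᵇ≡false p x ne =
  trans (posL-unique p (suc c0) xs c e (λ c' q → suc-injective (u (suc c') q))) (cong just (sym (+-suc c0 c)))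

posFrom-unique : ∀ p r0 S r c → get r c S ≡ just p → (∀ r' c' → get r' c' S ≡ just p → (r' , c') ≡ (r , c)) →
  posFrom p r0 S ≡ just (r0 + r , c)
posFrom-unique p r0 [] r c () u
posFrom-unique p r0 (x ∷ S) zero c e u
  rewrite posL-unique p 0 x c e (λ c' q → cong proj₂ (u 0 c' q)) =
    cong (λ t → just (t , c)) (sym (+-identityʳ r0))
posFrom-unique p r0 (x ∷ S) (suc r) c e u
  rewrite posL-absent p 0 x (λ c' q → 0≢1+n (cong proj₁ (u 0 c' q))) =
  trans (posFrom-unique p (suc r0) S r c e (λ r' c' q → cong (λ t → pred (proj₁ t) , proj₂ t) (u (suc r') c' q)))
        (cong (λ t → just (t , c)) (sym (+-suc r0 r)))

pos-unique : ∀ p S r c → get r c S ≡ just p → (∀ r' c' → get r' c' S ≡ just p → (r' , c') ≡ (r , c)) →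
  pos p S ≡ just (r , c)
pos-unique p S r c e u = posFrom-unique p 0 S r c e u

getL-map : ∀ (f : ℕ → ℕ) c xs → getL c (map f xs) ≡ Maybe.map f (getL c xs)
getL-map f c [] = refl
getL-map f zero (x ∷ xs) = refl
getL-map f (suc c) (x ∷ xs) = getL-map f c xs

get-map : ∀ (f : ℕ → ℕ) r c T → get r c (map (map f) T) ≡ Maybe.map f (get r c T)
get-map f r c [] = refl
get-map f zero c (x ∷ T) = getL-map f c x
get-map f (suc r) c (x ∷ T) = get-map f r c T

rowLength-map : ∀ (f : ℕ → ℕ) r T → rowLength r (map (map f) T) ≡ rowLength r T
rowLength-map f r [] = refl
rowLength-map f zero (x ∷ T) = List.length-map f x
rowLength-map f (suc r) (x ∷ T) = rowLength-map f r T

size-map : ∀ (f : ℕ → ℕ) T → size (map (map f) T) ≡ size T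
size-map f [] = refl
size-map f (x ∷ T) = cong₂ _+_ (List.length-map f x) (size-map f T)

-- Row words and Schützenberger's Δ

sucIfYes : ∀ {r k : ℕ} → Dec (r ≡ k) → ℕ → ℕ
sucIfYes (yes _) n = suc n
sucIfYes (no _) n = n

rowCount : ℕ → List ℕ → ℕ
rowCount r [] = 0
rowCount r (k ∷ ks) = sucIfYes (r ≟ k) (rowCount r ks)

rowCount-≡ : ∀ k ks → rowCount k (k ∷ ks) ≡ suc (rowCount k ks)
rowCount-≡ k ks with k ≟ k
... | yes _ = refl
... | no n = ⊥-elim (n refl)

rowCount-≢ : ∀ r k ks → r ≢ k → rowCount r (k ∷ ks) ≡ rowCount r ks
rowCount-≢ r k ks ne with r ≟ k
... | yes e = ⊥-elim (ne e)
... | no _ = refl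

data Neighbour : Cell → Cell → Set where
  right : ∀ r c → Neighbour (r , c) (r , suc c)
  below : ∀ r c → Neighbour (r , c) (suc r , c)

neighbour? : ∀ d z → Dec (Neighbour d z)
neighbour? (dr , dc) (zr , zc) with zr ≟ dr | zc ≟ suc dc
... | yes refl | yes refl = yes (right dr dc)
... | yes refl | no ne = no (λ { (right _ _) → ne refl })
neighbour? (dr , dc) (zr , zc) | no ne | _ with zr ≟ suc dr | zc ≟ dc
... | yes refl | yes refl = yes (below dr dc)
... | yes refl | no ne2 = no (λ { (below _ _) → ne2 refl })
... | no ne2 | _ = no (λ { (right _ _) → ne refl ; (below _ _) → ne2 refl })

Δ-step : (k zc : ℕ) → List ℕ → (d : Cell) → Dec (Neighbour d (k , zc)) → List ℕ × Cell
Δ-step k zc ks d (yes _) = (proj₁ d ∷ ks) , (k , zc)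
Δ-step k zc ks d (no _) = (k ∷ ks) , d

-- Δ (k ∷ ks) is the row word left after sliding out the smallest entry, with the vacated
-- cell (slide-fill).  The slide path is that of ks; the newest entry, in cell
-- (k , rowCount k ks), then moves into the cell vacated by it iff the two are adjacent.
Δ : List ℕ → List ℕ × Cell
Δ [] = [] , (0 , 0)
Δ (k ∷ []) = [] , (0 , 0)
Δ (k ∷ k2 ∷ ks) = Δ-step k (rowCount k (k2 ∷ ks)) (proj₁ (Δ (k2 ∷ ks))) (proj₂ (Δ (k2 ∷ ks)))
                       (neighbour? (proj₂ (Δ (k2 ∷ ks))) (k , rowCount k (k2 ∷ ks)))

Δword : List ℕ → List ℕ
Δword ks = proj₁ (Δ ks)

Δcell : List ℕ → Cell
Δcell ks = proj₂ (Δ ks)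

Δrow Δcol : List ℕ → ℕ
Δrow ks = proj₁ (Δcell ks)
Δcol ks = proj₂ (Δcell ks)

Addable : ℕ → List ℕ → Set
Addable zero ks = ⊤
Addable (suc k) ks = rowCount (suc k) ks < rowCount k ks

Yamanouchi : List ℕ → Set
Yamanouchi [] = ⊤
Yamanouchi (k ∷ ks) = Addable k ks × Yamanouchi ks

rowCount-suc≤ : ∀ ks → Yamanouchi ks → ∀ r → rowCount (suc r) ks ≤ rowCount r ks
rowCount-suc≤ [] _ r = z≤n
rowCount-suc≤ (k ∷ ks) (ad , v) r with suc r ≟ k | r ≟ k
rowCount-suc≤ (k ∷ ks) (ad , v) r | yes refl | yes e = ⊥-elim (1+n≢n (sym e))
rowCount-suc≤ (.(suc r) ∷ ks) (ad , v) r | yes refl | no _ = ad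
rowCount-suc≤ (k ∷ ks) (ad , v) r | no _ | yes _ = m≤n⇒m≤1+n (rowCount-suc≤ ks v r)
rowCount-suc≤ (k ∷ ks) (ad , v) r | no _ | no _ = rowCount-suc≤ ks v r

record RemovesCorner (ks ks' : List ℕ) (dr dc : ℕ) : Set where
  field
    corner-row : rowCount dr ks ≡ suc dc
    corner-outer : rowCount (suc dr) ks ≤ dc
    removed-row : rowCount dr ks' ≡ dc
    other-rows : ∀ r → r ≢ dr → rowCount r ks' ≡ rowCount r ks
    yamanouchi : Yamanouchi ks'
    one-shorter : suc (length ks') ≡ length ks

open RemovesCorner

non-neighbour⇒row≢ : ∀ {L L' k zc dr dc} → RemovesCorner L L' dr dc → rowCount k L ≡ zc →
  ¬ Neighbour (dr , dc) (k , zc) → k ≢ dr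
non-neighbour⇒row≢ {k = k} {dc = dc} fs eq nn refl =
  nn (subst (λ t → Neighbour (k , dc) (k , t)) (trans (sym (corner-row fs)) eq) (right k dc))

corner-addable : ∀ dr dc L L' → Yamanouchi L → RemovesCorner L L' dr dc → Addable dr L'
corner-addable zero dc L L' v fs = tt
corner-addable (suc q) dc L L' v fs =
  subst₂ _<_ (sym (removed-row fs)) (sym (other-rows fs q (λ e → 1+n≢n (sym e))))
                  (≤-trans (≤-reflexive (sym (corner-row fs))) (rowCount-suc≤ L v q))

addable-after-removal : ∀ k zc L L' dr dc → Addable k L → rowCount k L ≡ zc → RemovesCorner L L' dr dc →
  k ≢ dr →
  (k ≡ suc dr → zc < dc) → Addable k L'
addable-after-removal zero zc L L' dr dc ad eq fs kd zd = tt
addable-after-removal (suc q) zc L L' dr dc ad eq fs kd zd with q ≟ dr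
... | yes refl = subst₂ _<_ (sym (trans (other-rows fs (suc dr) 1+n≢n) eq)) (sym (removed-row fs)) (zd refl)
... | no qn = subst₂ _<_ (sym (other-rows fs (suc q) kd)) (sym (other-rows fs q qn)) ad

removesCorner-moves-left : ∀ dr dc L L' → Yamanouchi L → rowCount dr L ≡ suc dc → RemovesCorner L L' dr dc →
  RemovesCorner (dr ∷ L) (dr ∷ L') dr (suc dc)
removesCorner-moves-left dr dc L L' v eq fs = record
  { corner-row = trans (rowCount-≡ dr L) (cong suc eq)
  ; corner-outer = subst (_≤ suc dc) (sym (rowCount-≢ (suc dr) dr L 1+n≢n))
      (subst (rowCount (suc dr) L ≤_) eq (rowCount-suc≤ L v dr))
  ; removed-row = trans (rowCount-≡ dr L') (cong suc (removed-row fs))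
  ; other-rows = λ r ne →
    trans (rowCount-≢ r dr L' ne) (trans (other-rows fs r ne) (sym (rowCount-≢ r dr L ne)))
  ; yamanouchi = corner-addable dr dc L L' v fs , yamanouchi fs
  ; one-shorter = cong suc (one-shorter fs) }

removesCorner-moves-up : ∀ dr dc L L' → Yamanouchi L → rowCount (suc dr) L ≡ dc → RemovesCorner L L' dr dc →
  RemovesCorner (suc dr ∷ L) (dr ∷ L') (suc dr) dc
removesCorner-moves-up dr dc L L' v eq fs = record
  { corner-row = trans (rowCount-≡ (suc dr) L) (cong suc eq)
  ; corner-outer = subst (_≤ dc) (sym (rowCount-≢ (suc (suc dr)) (suc dr) L 1+n≢n))
      (subst (rowCount (suc (suc dr)) L ≤_) eq (rowCount-suc≤ L v (suc dr)))
  ; removed-row = trans (rowCount-≢ (suc dr) dr L' 1+n≢n) (trans (other-rows fs (suc dr) 1+n≢n) eq)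
  ; other-rows = other
  ; yamanouchi = corner-addable dr dc L L' v fs , yamanouchi fs
  ; one-shorter = cong suc (one-shorter fs) }
  where
  other : ∀ r → r ≢ suc dr → rowCount r (dr ∷ L') ≡ rowCount r (suc dr ∷ L)
  other r ne with r ≟ dr
  ... | yes refl = trans (cong suc (removed-row fs))
      (trans (sym (corner-row fs)) (sym (rowCount-≢ dr (suc dr) L ne)))
  ... | no ne2 = trans (other-rows fs r ne2) (sym (rowCount-≢ r (suc dr) L ne))

removesCorner-stays : ∀ k zc L L' dr dc → Addable k L → rowCount k L ≡ zc → RemovesCorner L L' dr dc →
  ¬ Neighbour (dr , dc) (k , zc) → RemovesCorner (k ∷ L) (k ∷ L') dr dc
removesCorner-stays k zc L L' dr dc ad eq fs nn = record
  { corner-row = trans (rowCount-≢ dr k L (λ e → k≢dr (sym e))) (corner-row fs)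
  ; corner-outer = outer
  ; removed-row = trans (rowCount-≢ dr k L' (λ e → k≢dr (sym e))) (removed-row fs)
  ; other-rows = λ r ne → cong (sucIfYes (r ≟ k)) (other-rows fs r ne)
  ; yamanouchi = addable-after-removal k zc L L' dr dc ad eq fs k≢dr zc<dc , yamanouchi fs
  ; one-shorter = cong suc (one-shorter fs) }
  where
  k≢dr : k ≢ dr
  k≢dr = non-neighbour⇒row≢ fs eq nn
  zc<dc : k ≡ suc dr → zc < dc
  zc<dc refl with m≤n⇒m<n∨m≡n (≤-pred (subst₂ _<_ eq (corner-row fs) ad))
  ... | inj₁ lt = lt
  ... | inj₂ refl = ⊥-elim (nn (below dr zc))
  outer : rowCount (suc dr) (k ∷ L) ≤ dc
  outer with suc dr ≟ k
  ... | yes refl = subst (λ t → suc t ≤ dc) (sym eq) (zc<dc refl)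
  ... | no _ = corner-outer fs

Δ-step-removesCorner : ∀ k zc L L' dr dc → Yamanouchi L → Addable k L → rowCount k L ≡ zc →
  RemovesCorner L L' dr dc →
  (D : Dec (Neighbour (dr , dc) (k , zc))) →
  let (L″ , (dr′ , dc′)) = Δ-step k zc L' (dr , dc) D in RemovesCorner (k ∷ L) L″ dr′ dc′
Δ-step-removesCorner .dr .(suc dc) L L' dr dc v ad eq fs (yes (right .dr .dc)) =
  removesCorner-moves-left dr dc L L' v eq fs
Δ-step-removesCorner .(suc dr) .dc L L' dr dc v ad eq fs (yes (below .dr .dc)) =
  removesCorner-moves-up dr dc L L' v eq fs
Δ-step-removesCorner k zc L L' dr dc v ad eq fs (no nn) = removesCorner-stays k zc L L' dr dc ad eq fs nn

Δ-removesCorner : ∀ k ks → Yamanouchi (k ∷ ks) →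
  RemovesCorner (k ∷ ks) (Δword (k ∷ ks)) (Δrow (k ∷ ks)) (Δcol (k ∷ ks))
Δ-removesCorner zero [] _ = record
  { corner-row = refl ; corner-outer = z≤n ; removed-row = refl
  ; other-rows = λ r ne → sym (rowCount-≢ r 0 [] ne) ; yamanouchi = tt ; one-shorter = refl }
Δ-removesCorner (suc k) [] (() , _)
Δ-removesCorner k (k2 ∷ ks) (ad , v) =
  Δ-step-removesCorner k (rowCount k (k2 ∷ ks)) (k2 ∷ ks) (Δword (k2 ∷ ks)) (Δrow (k2 ∷ ks))
    (Δcol (k2 ∷ ks)) v ad refl (Δ-removesCorner k2 ks v)
      (neighbour? (Δcell (k2 ∷ ks)) (k , rowCount k (k2 ∷ ks)))

removesCorner-length : ∀ {ks ks' dr dc n} → RemovesCorner ks ks' dr dc → length ks ≡ suc n → length ks' ≡ n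
removesCorner-length fs e = suc-injective (trans (one-shorter fs) e)

Δ-removesCorner′ : ∀ {n} ks → Yamanouchi ks → length ks ≡ suc n →
  RemovesCorner ks (Δword ks) (Δrow ks) (Δcol ks)
Δ-removesCorner′ (k ∷ ks) v _ = Δ-removesCorner k ks v

fill : ℕ → List ℕ → Tableau
fill a [] = []
fill a (k ∷ ks) = appendAt k (a + length ks) (fill a ks)

neighbour⇒≢ : ∀ {d z} → Neighbour d z → d ≢ z
neighbour⇒≢ (right r c) e = 1+n≢n (sym (cong proj₂ e))
neighbour⇒≢ (below r c) e = 1+n≢n (sym (cong proj₁ e))

neighbour-distance : ∀ {r c r′ c′} → Neighbour (r , c) (r′ , c′) → r′ + c′ ≡ suc (r + c)
neighbour-distance (right r c) = +-suc r c
neighbour-distance (below r c) = refl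

rowLength-fill : ∀ a ks → Yamanouchi ks → ∀ r → rowLength r (fill a ks) ≡ rowCount r ks
addable⇒≤length : ∀ a k ks → Yamanouchi ks → Addable k ks → k ≤ length (fill a ks)

rowLength-fill a [] v r = refl
rowLength-fill a (k ∷ ks) (ad , v) r with r ≟ k
... | yes refl = trans (rowLength-appendAt-≡ k (a + length ks) (fill a ks) (addable⇒≤length a k ks v ad))
                   (cong suc (rowLength-fill a ks v k))
... | no ne = trans (rowLength-appendAt-≢ k (a + length ks) (fill a ks) r (addable⇒≤length a k ks v ad) ne)
                (rowLength-fill a ks v r)

addable⇒≤length a zero ks v ad = z≤n
addable⇒≤length a (suc q) ks v ad =
  rowLength-pos⇒< q (fill a ks) (subst (0 <_) (sym (rowLength-fill a ks v q)) (≤-trans (s≤s z≤n) ad))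

noEmptyRows-fill : ∀ a ks → NoEmptyRows (fill a ks)
noEmptyRows-fill a [] = []
noEmptyRows-fill a (k ∷ ks) = noEmptyRows-appendAt k (a + length ks) (fill a ks) (noEmptyRows-fill a ks)

size-fill : ∀ a ks → size (fill a ks) ≡ length ks
size-fill a [] = refl
size-fill a (k ∷ ks) = trans (size-appendAt k (a + length ks) (fill a ks)) (cong suc (size-fill a ks))

fill-entries< : ∀ a ks → Yamanouchi ks → ∀ r c v → get r c (fill a ks) ≡ just v → v < a + length ks
fill-entries< a [] v r c w ()
fill-entries< a (k ∷ ks) (ad , vl) r c w e with (r , c) ≟ᶜ (k , rowLength k (fill a ks))
... | yes refl with trans (sym e)
    (get-appendAt-≡ k (a + length ks) (fill a ks) (addable⇒≤length a k ks vl ad))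
...   | refl = ≤-reflexive (sym (+-suc a (length ks)))
fill-entries< a (k ∷ ks) (ad , vl) r c w e | no ne =
  ≤-trans (fill-entries< a ks vl r c w
    (trans (sym (get-appendAt-≢ k (a + length ks) (fill a ks) r c (addable⇒≤length a k ks vl ad) ne)) e))
          (+-monoʳ-≤ a (n≤1+n _))

rowCount≤rowCount0 : ∀ L → Yamanouchi L → ∀ r → rowCount r L ≤ rowCount 0 L
rowCount≤rowCount0 L v zero = ≤-refl
rowCount≤rowCount0 L v (suc r) = ≤-trans (rowCount-suc≤ L v r) (rowCount≤rowCount0 L v r)

rowCount0-pos : ∀ k L → Yamanouchi (k ∷ L) → 0 < rowCount 0 (k ∷ L)
rowCount0-pos k L v = ≤-trans (subst (1 ≤_) (sym (rowCount-≡ k L)) (s≤s z≤n)) (rowCount≤rowCount0 (k ∷ L) v k)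

rowCount-antitone : ∀ L → Yamanouchi L → ∀ r s → r ≤ s → rowCount s L ≤ rowCount r L
rowCount-antitone L v r zero z≤n = ≤-refl
rowCount-antitone L v r (suc s) le with m≤n⇒m<n∨m≡n le
... | inj₂ refl = ≤-refl
... | inj₁ lt = ≤-trans (rowCount-suc≤ L v s) (rowCount-antitone L v r s (≤-pred lt))

Δ-∷ : ∀ {n} r X → length X ≡ suc n →
  Δ (r ∷ X) ≡ Δ-step r (rowCount r X) (Δword X) (Δcell X) (neighbour? (Δcell X) (r , rowCount r X))
Δ-∷ r (x ∷ X) _ = refl

-- The cell of the entry added i-th, counting from 0.
cellOf : List ℕ → ℕ → Cell
cellOf [] i = (0 , 0)
cellOf (k ∷ ks) i with i ≟ length ks
... | yes _ = (k , rowCount k ks)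
... | no _ = cellOf ks i

cellOf-last : ∀ k ks i → i ≡ length ks → cellOf (k ∷ ks) i ≡ (k , rowCount k ks)
cellOf-last k ks i e with i ≟ length ks
... | yes _ = refl
... | no n = ⊥-elim (n e)

cellOf-earlier : ∀ k ks i → i ≢ length ks → cellOf (k ∷ ks) i ≡ cellOf ks i
cellOf-earlier k ks i ne with i ≟ length ks
... | yes e = ⊥-elim (ne e)
... | no n = refl

-- A jeu de taquin slide realises Δ

slideStep : ℕ → ℕ → ℕ → Tableau → Maybe ℕ → Maybe ℕ → Tableau × (ℕ × ℕ)
slideStep f r c T nothing nothing = del r c T , (r , c)
slideStep f r c T (just a) nothing = slide f r (suc c) (set r c a T)
slideStep f r c T nothing (just b) = slide f (suc r) c (set r c b T)
slideStep f r c T (just a) (just b) = if a <ᵇ b then slide f r (suc c) (set r c a T)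
                                        else slide f (suc r) c (set r c b T)

slide-unfold : ∀ f r c T → slide (suc f) r c T ≡ slideStep f r c T (get r (suc c) T) (get (suc r) c T)
slide-unfold f r c T with get r (suc c) T | get (suc r) c T
... | nothing | nothing = refl
... | just a | nothing = refl
... | nothing | just b = refl
... | just a | just b = refl

slide-stop : ∀ f r c T → get r (suc c) T ≡ nothing → get (suc r) c T ≡ nothing →
  slide f r c T ≡ (del r c T , (r , c))
slide-stop zero r c T e1 e2 = refl
slide-stop (suc f) r c T e1 e2 rewrite slide-unfold f r c T | e1 | e2 = refl

Extends : Tableau → Tableau → ℕ → ℕ → ℕ → Set
Extends T U zr zc m = (get zr zc T ≡ just m) × (∀ r c → (r , c) ≢ (zr , zc) → get r c T ≡ get r c U)

record AddedCorner (T U : Tableau) (zr zc m : ℕ) : Set where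
  field
    rows-T : NoEmptyRows T
    rows-U : NoEmptyRows U
    extends : Extends T U zr zc m
    hole : get zr zc U ≡ nothing
    maximal : ∀ r c v → get r c U ≡ just v → v < m
    outer-right : get zr (suc zc) T ≡ nothing
    outer-below : get (suc zr) zc T ≡ nothing

open AddedCorner

addedCorner-get : ∀ {T U zr zc m} → AddedCorner T U zr zc m → ∀ r c {v} → get r c U ≡ just v → get r c T ≡ just v
addedCorner-get {U = U} ac r c e = trans (proj₂ (extends ac) r c (just-nothing⇒≢ U r c _ _ e (hole ac))) e

-- The outcomes of sliding T and U: either U's hole ends next to (zr , zc) and m moves
-- into it, or m stays where it is.
SlidesAgree : (Tableau × Cell) → (Tableau × Cell) → ℕ → ℕ → ℕ → Set
SlidesAgree (X , d) (Y , e) zr zc m =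
  NoEmptyRows X × ((Neighbour e (zr , zc) × d ≡ (zr , zc) × Extends X Y (proj₁ e) (proj₂ e) m)
               ⊎ (¬ Neighbour e (zr , zc) × d ≡ e × Extends X Y zr zc m))

corner⇒removable : ∀ r c T → NoEmptyRows T → c < rowLength r T → get r (suc c) T ≡ nothing →
  get (suc r) c T ≡ nothing → Removable r c T
corner⇒removable r c T ne lt e1 e2 =
  removable r c T ne (≤-antisym (get-nothing⇒≥ r (suc c) T e1) lt)
    (λ { refl → n≤0⇒n≡0 (get-nothing⇒≥ (suc r) 0 T e2) })

extends-inside : ∀ T U zr zc m r c → Extends T U zr zc m → get zr zc U ≡ nothing → c < rowLength r U →
  c < rowLength r T
extends-inside T U zr zc m r c (_ , agree) zn lt with get-<⇒just r c U lt
... | v , ev = get-just⇒< r c T (trans (agree r c (inside⇒≢hole U zr zc r c zn lt)) ev)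

extends-set : ∀ T U zr zc m r c v → Extends T U zr zc m → (r , c) ≢ (zr , zc) → c < rowLength r T →
  c < rowLength r U →
  Extends (set r c v T) (set r c v U) zr zc m
extends-set T U zr zc m r c v (e1 , e2) ne lt1 lt2 =
  trans (get-set-≢ r c v T zr zc (λ q → ne (sym q))) e1 , agree
  where
  agree : ∀ r' c' → (r' , c') ≢ (zr , zc) → get r' c' (set r c v T) ≡ get r' c' (set r c v U)
  agree r' c' n with (r' , c') ≟ᶜ (r , c)
  ... | yes refl = trans (get-set-≡ r c v T lt1) (sym (get-set-≡ r c v U lt2))
  ... | no n2 = trans (get-set-≢ r c v T r' c' n2) (trans (e2 r' c' n) (sym (get-set-≢ r c v U r' c' n2)))

extends-del : ∀ T U zr zc m r c → NoEmptyRows T → NoEmptyRows U → Extends T U zr zc m →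
  Removable r c T → Removable r c U → (r , c) ≢ (zr , zc) → Extends (del r c T) (del r c U) zr zc m
extends-del T U zr zc m r c neT neU (e1 , e2) dokT dokU rc≢z =
  trans (get-del-≢ r c T neT dokT zr zc (λ q → rc≢z (sym q))) e1 , agree
  where
  agree : ∀ r' c' → (r' , c') ≢ (zr , zc) → get r' c' (del r c T) ≡ get r' c' (del r c U)
  agree r' c' n with (r' , c') ≟ᶜ (r , c)
  ... | yes refl = trans (get-del-≡ r c T neT dokT) (sym (get-del-≡ r c U neU dokU))
  ... | no n2 = trans (get-del-≢ r c T neT dokT r' c' n2)
      (trans (e2 r' c' n) (sym (get-del-≢ r c U neU dokU r' c' n2)))

addedCorner-set : ∀ {T U zr zc m} r c a → AddedCorner T U zr zc m → c < rowLength r U → a < m →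
  AddedCorner (set r c a T) (set r c a U) zr zc m
addedCorner-set {T} {U} {zr} {zc} {m} r c a ac lt a<m = record
  { rows-T = noEmptyRows-set r c a T (rows-T ac)
  ; rows-U = noEmptyRows-set r c a U (rows-U ac)
  ; extends = extends-set T U zr zc m r c a (extends ac) (inside⇒≢hole U zr zc r c (hole ac) lt)
                (extends-inside T U zr zc m r c (extends ac) (hole ac) lt) lt
  ; hole = get-set-nothing r c a U zr zc (hole ac)
  ; maximal = λ r′ c′ v e → [ (λ { refl → a<m }) , maximal ac r′ c′ v ]′ (get-set-just r c a U r′ c′ v e)
  ; outer-right = get-set-nothing r c a T zr (suc zc) (outer-right ac)
  ; outer-below = get-set-nothing r c a T (suc zr) zc (outer-below ac)
  }

extends-after-move : ∀ T U zr zc m r c → Neighbour (r , c) (zr , zc) → AddedCorner T U zr zc m →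
  c < rowLength r U →
  get r (suc c) U ≡ nothing → get (suc r) c U ≡ nothing →
  Extends (del zr zc (set r c m T)) (del r c U) r c m
extends-after-move T U zr zc m r c nr ac lt ur ud =
  trans (get-del-≢ zr zc ST neST dok r c (neighbour⇒≢ nr)) (get-set-≡ r c m T ltT) , agree
  where
  ST = set r c m T
  neST = noEmptyRows-set r c m T (rows-T ac)
  ltT = extends-inside T U zr zc m r c (extends ac) (hole ac) lt
  dok : Removable zr zc ST
  dok = corner⇒removable zr zc ST neST
          (subst (zc <_) (sym (rowLength-set r c m T zr)) (get-just⇒< zr zc T (proj₁ (extends ac))))
          (get-set-nothing r c m T zr (suc zc) (outer-right ac))
            (get-set-nothing r c m T (suc zr) zc (outer-below ac))
  dokU : Removable r c U
  dokU = corner⇒removable r c U (rows-U ac) lt ur ud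
  agree : ∀ r' c' → (r' , c') ≢ (r , c) → get r' c' (del zr zc ST) ≡ get r' c' (del r c U)
  agree r' c' n with (r' , c') ≟ᶜ (zr , zc)
  ... | yes refl = trans (get-del-≡ zr zc ST neST dok)
                     (sym (trans (get-del-≢ r c U (rows-U ac) dokU zr zc (λ q → neighbour⇒≢ nr (sym q)))
                       (hole ac)))
  ... | no n2 = trans (get-del-≢ zr zc ST neST dok r' c' n2)
                 (trans (get-set-≢ r c m T r' c' n)
                 (trans (proj₂ (extends ac) r' c' n2) (sym (get-del-≢ r c U (rows-U ac) dokU r' c' n))))

slide-sim-stop : ∀ F r c T U zr zc m → AddedCorner T U zr zc m → c < rowLength r U →
  get r (suc c) U ≡ nothing → get (suc r) c U ≡ nothing →
  SlidesAgree (slide (suc F) r c T) (del r c U , (r , c)) zr zc m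
slide-sim-stop F r c T U zr zc m ac lt ur ud with (r , suc c) ≟ᶜ (zr , zc)
... | yes refl rewrite slide-unfold F r c T | proj₁ (extends ac) | proj₂ (extends ac) (suc r) c
    (λ q → 1+n≢n (cong proj₁ q)) | ud
      | slide-stop F r (suc c) (set r c m T) (get-set-nothing r c m T r (suc (suc c)) (outer-right ac))
                                             (get-set-nothing r c m T (suc r) (suc c) (outer-below ac)) =
  noEmptyRows-del r (suc c) (set r c m T) ,
  inj₁ (right r c , refl , extends-after-move T U r (suc c) m r c (right r c) ac lt ur ud)
... | no n1 with (suc r , c) ≟ᶜ (zr , zc)
...   | yes refl rewrite slide-unfold F r c T | proj₁ (extends ac) | proj₂ (extends ac) r (suc c) n1 | ur
      | slide-stop F (suc r) c (set r c m T) (get-set-nothing r c m T (suc r) (suc c) (outer-right ac))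
                                             (get-set-nothing r c m T (suc (suc r)) c (outer-below ac)) =
  noEmptyRows-del (suc r) c (set r c m T) ,
  inj₁ (below r c , refl , extends-after-move T U (suc r) c m r c (below r c) ac lt ur ud)
...   | no n2 rewrite slide-stop (suc F) r c T (trans (proj₂ (extends ac) r (suc c) n1) ur)
                                          (trans (proj₂ (extends ac) (suc r) c n2) ud) =
  noEmptyRows-del r c T , inj₂ (not-neighbour , refl ,
    extends-del T U zr zc m r c (rows-T ac) (rows-U ac) (extends ac) dokT dokU
      (inside⇒≢hole U zr zc r c (hole ac) lt))
  where
  not-neighbour : ¬ Neighbour (r , c) (zr , zc)
  not-neighbour (right .r .c) = n1 refl
  not-neighbour (below .r .c) = n2 refl
  dokT : Removable r c T
  dokT = corner⇒removable r c T (rows-T ac) (extends-inside T U zr zc m r c (extends ac) (hole ac) lt)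
           (trans (proj₂ (extends ac) r (suc c) n1) ur) (trans (proj₂ (extends ac) (suc r) c n2) ud)
  dokU : Removable r c U
  dokU = corner⇒removable r c U (rows-U ac) lt ur ud

no-right-neighbour : ∀ r c U → NoEmptyRows U → r + c ≡ size U → get r (suc c) U ≡ nothing
no-right-neighbour r c U ne e with get r (suc c) U in eq
... | nothing = refl
... | just v = ⊥-elim (<-irrefl e (<-trans (n<1+n (r + c))
                 (subst (_< size U) (+-suc r c)
                   (row+column<size r (suc c) U ne (get-just⇒< r (suc c) U eq)))))

no-lower-neighbour : ∀ r c U → NoEmptyRows U → r + c ≡ size U → get (suc r) c U ≡ nothing
no-lower-neighbour r c U ne e with get (suc r) c U in eq
... | nothing = refl
... | just v = ⊥-elim (<-irrefl e (<-trans (n<1+n (r + c))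
                 (row+column<size (suc r) c U ne (get-just⇒< (suc r) c U eq))))

-- The slide in T follows the slide in U, since m exceeds every entry, until its hole
-- reaches a neighbour of (zr , zc); only then can m move.
slide-sim : ∀ f r c T U zr zc m → AddedCorner T U zr zc m → c < rowLength r U → f + (r + c) ≡ size U →
  SlidesAgree (slide (suc f) r c T) (slide f r c U) zr zc m

slide-sim-move : ∀ f r c r′ c′ a T U zr zc m → AddedCorner T U zr zc m → c < rowLength r U →
  Neighbour (r , c) (r′ , c′) → get r′ c′ U ≡ just a → suc f + (r + c) ≡ size U →
  SlidesAgree (slide (suc f) r′ c′ (set r c a T)) (slide f r′ c′ (set r c a U)) zr zc m
slide-sim-move f r c r′ c′ a T U zr zc m ac lt nb ea fu =
  slide-sim f r′ c′ (set r c a T) (set r c a U) zr zc m (addedCorner-set r c a ac lt (maximal ac r′ c′ a ea))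
    (subst (c′ <_) (sym (rowLength-set r c a U r′)) (get-just⇒< r′ c′ U ea))
    (trans (cong (f +_) (neighbour-distance nb))
      (trans (+-suc f (r + c)) (trans fu (sym (size-set r c a U)))))

slide-sim zero r c T U zr zc m ac lt fu =
  slide-sim-stop zero r c T U zr zc m ac lt (no-right-neighbour r c U (rows-U ac) fu)
    (no-lower-neighbour r c U (rows-U ac) fu)
slide-sim (suc f) r c T U zr zc m ac lt fu
  rewrite slide-unfold f r c U with get r (suc c) U in eR | get (suc r) c U in eD
... | nothing | nothing = slide-sim-stop (suc f) r c T U zr zc m ac lt eR eD
... | just a | nothing with (suc r , c) ≟ᶜ (zr , zc)
...   | yes refl rewrite slide-unfold (suc f) r c T | proj₁ (extends ac) | addedCorner-get ac r (suc c) eR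
                       | <⇒<ᵇ≡true (maximal ac r (suc c) a eR) =
  slide-sim-move f r c r (suc c) a T U (suc r) c m ac lt (right r c) eR fu
...   | no n2 rewrite slide-unfold (suc f) r c T | addedCorner-get ac r (suc c) eR
                    | trans (proj₂ (extends ac) (suc r) c n2) eD =
  slide-sim-move f r c r (suc c) a T U zr zc m ac lt (right r c) eR fu
slide-sim (suc f) r c T U zr zc m ac lt fu | nothing | just b with (r , suc c) ≟ᶜ (zr , zc)
...   | yes refl rewrite slide-unfold (suc f) r c T | proj₁ (extends ac) | addedCorner-get ac (suc r) c eD
                       | ≥⇒<ᵇ≡false (<⇒≤ (maximal ac (suc r) c b eD)) =
  slide-sim-move f r c (suc r) c b T U r (suc c) m ac lt (below r c) eD fu
...   | no n1 rewrite slide-unfold (suc f) r c T | trans (proj₂ (extends ac) r (suc c) n1) eR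
                    | addedCorner-get ac (suc r) c eD =
  slide-sim-move f r c (suc r) c b T U zr zc m ac lt (below r c) eD fu
slide-sim (suc f) r c T U zr zc m ac lt fu | just a | just b
  rewrite slide-unfold (suc f) r c T | addedCorner-get ac r (suc c) eR | addedCorner-get ac (suc r) c eD
  with a <ᵇ b
... | true = slide-sim-move f r c r (suc c) a T U zr zc m ac lt (right r c) eR fu
... | false = slide-sim-move f r c (suc r) c b T U zr zc m ac lt (below r c) eD fu

extends⇒appendAt : ∀ X Y zr zc m → NoEmptyRows X → NoEmptyRows Y → Extends X Y zr zc m → zr ≤ length Y →
  rowLength zr Y ≡ zc →
  X ≡ appendAt zr m Y
extends⇒appendAt X Y zr zc m neX neY (e1 , e2) le rl =
  get-ext X (appendAt zr m Y) neX (noEmptyRows-appendAt zr m Y neY) h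
  where
  h : ∀ r c → get r c X ≡ get r c (appendAt zr m Y)
  h r c with (r , c) ≟ᶜ (zr , zc)
  ... | yes refl = trans e1
      (sym (subst (λ t → get zr t (appendAt zr m Y) ≡ just m) rl (get-appendAt-≡ zr m Y le)))
  ... | no ne = trans (e2 r c ne) (sym (get-appendAt-≢ zr m Y r c le (λ q → ne (trans q (cong (zr ,_) rl)))))

fill-addedCorner : ∀ a k L → Yamanouchi (k ∷ L) →
  AddedCorner (fill a (k ∷ L)) (fill a L) k (rowCount k L) (a + length L)
fill-addedCorner a k L (ad , v) = record
  { rows-T = noEmptyRows-fill a (k ∷ L)
  ; rows-U = noEmptyRows-fill a L
  ; extends = subst (λ t → get k t F ≡ just m) row-k (get-appendAt-≡ k m U k≤) ,
              λ r c ne → get-appendAt-≢ k m U r c k≤ (λ q → ne (trans q (cong (k ,_) row-k)))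
  ; hole = get-≥⇒nothing k zc U (≤-reflexive row-k)
  ; maximal = fill-entries< a L v
  ; outer-right = get-≥⇒nothing k (suc zc) F
    (≤-reflexive (trans (rowLength-appendAt-≡ k m U k≤) (cong suc row-k)))
  ; outer-below = get-≥⇒nothing (suc k) zc F
      (≤-trans (≤-reflexive
        (trans (rowLength-appendAt-≢ k m U (suc k) k≤ 1+n≢n) (rowLength-fill a L v (suc k))))
               (rowCount-suc≤ L v k))
  }
  where
  U = fill a L
  m = a + length L
  zc = rowCount k L
  F = appendAt k m U
  k≤ = addable⇒≤length a k L v ad
  row-k : rowLength k U ≡ zc
  row-k = rowLength-fill a L v k

extends-fill : ∀ X b r c m L → NoEmptyRows X → Yamanouchi (r ∷ L) → rowCount r L ≡ c → m ≡ b + length L →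
  Extends X (fill b L) r c m → X ≡ fill b (r ∷ L)
extends-fill X b r c m L neX (ad , v) rc refl ex =
  extends⇒appendAt X (fill b L) r c m neX (noEmptyRows-fill b L) ex (addable⇒≤length b r L v ad)
    (trans (rowLength-fill b L v r) rc)

slide-sim⇒Δ-step : ∀ (X : Tableau) (dd : Cell) a k zc L L' dr dc m → Yamanouchi L → RemovesCorner L L' dr dc →
  rowCount k L ≡ zc → Addable k L → m ≡ suc a + length L' →
    SlidesAgree (X , dd) (fill (suc a) L' , (dr , dc)) k zc m →
  (X , dd) ≡ (fill (suc a) (proj₁ (Δ-step k zc L' (dr , dc) (neighbour? (dr , dc) (k , zc)))) ,
              proj₂ (Δ-step k zc L' (dr , dc) (neighbour? (dr , dc) (k , zc))))
slide-sim⇒Δ-step X dd a k zc L L' dr dc m v fs eq ad me (neX , sr) with neighbour? (dr , dc) (k , zc) | sr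
... | yes nr | inj₂ (nn , _) = ⊥-elim (nn nr)
... | no nn | inj₁ (nr , _) = ⊥-elim (nn nr)
... | yes nr | inj₁ (_ , refl , ex) =
  cong₂ _,_ (extends-fill X (suc a) dr dc m L' neX (corner-addable dr dc L L' v fs , yamanouchi fs)
    (removed-row fs) me ex) refl
... | no nn | inj₂ (_ , refl , ex) =
  cong₂ _,_ (extends-fill X (suc a) k zc m L' neX
    (yamanouchi (Δ-step-removesCorner k zc L L' dr dc v ad eq fs (no nn)))
                           (trans (other-rows fs k (non-neighbour⇒row≢ fs eq nn)) eq) me ex) refl

slide-fill : ∀ a k ks → Yamanouchi (k ∷ ks) →
  slide (size (fill a (k ∷ ks))) 0 0 (fill a (k ∷ ks)) ≡ (fill (suc a) (Δword (k ∷ ks)) , Δcell (k ∷ ks))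
slide-fill a zero [] v = refl
slide-fill a (suc k) [] (() , _)
slide-fill a k L@(k2 ∷ ks₀) (ad , v) =
  subst (λ s → slide s 0 0 (fill a (k ∷ L)) ≡ (fill (suc a) (Δword (k ∷ L)) , Δcell (k ∷ L)))
    (sym (size-appendAt k m (fill a L)))
    (slide-sim⇒Δ-step _ _ a k (rowCount k L) L (Δword L) (Δrow L) (Δcol L) m v fs refl ad
      (trans (cong (a +_) (sym (one-shorter fs))) (+-suc a _))
      (subst (λ w → SlidesAgree (slide (suc (size (fill a L))) 0 0 (fill a (k ∷ L))) w k (rowCount k L) m)
        (slide-fill a k2 ks₀ v)
        (slide-sim (size (fill a L)) 0 0 _ _ k (rowCount k L) m (fill-addedCorner a k L (ad , v))
          (subst (0 <_) (sym (rowLength-fill a L v 0)) (rowCount0-pos k2 ks₀ v)) (+-identityʳ _))))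
  where
  m = a + length L
  fs = Δ-removesCorner k2 ks₀ v

-- Δ transports ascents and descents

Descent : Cell → Cell → Set
Descent (r , c) (r' , c') = r < r' × c' ≤ c

Ascent : Cell → Cell → Set
Ascent (r , c) (r' , c') = r' ≤ r × c < c'

Transfers : Cell → Cell → Cell → Cell → Set
Transfers x y x' y' = (Descent x y → Descent x' y') × (Ascent x y → Ascent x' y')

transfers-refl : ∀ {x y} → Transfers x y x y
transfers-refl = (λ d → d) , (λ a → a)

transfers-trans : ∀ {a b c d e f} → Transfers a b c d → Transfers c d e f → Transfers a b e f
transfers-trans (p , q) (p2 , q2) = (λ t → p2 (p t)) , (λ t → q2 (q t))

transfers-subst : ∀ {a b c d a' b' c' d'} → a ≡ a' → b ≡ b' → c ≡ c' → d ≡ d' → Transfers a' b' c' d' →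
  Transfers a b c d
transfers-subst refl refl refl refl r = r

-- In the next lemmas (p , q) and (k , zc) hold the two newest entries and (dr , dc) is the
-- cell vacated when Δ slides the older ones; each treats one way the two entries can move.
no-addable-cell-below-corner : ∀ L₀ L₀' dr dc p → Yamanouchi L₀ → RemovesCorner L₀ L₀' dr dc →
  rowCount p L₀ ≡ dc → Addable p L₀ → ¬ Neighbour (dr , dc) (p , dc) → dr ≤ p → ⊥
no-addable-cell-below-corner L₀ L₀' dr dc p v fs eq ad nn le with p ≟ dr
... | yes refl = 1+n≢n (trans (sym (corner-row fs)) eq)
no-addable-cell-below-corner L₀ L₀' dr dc zero v fs eq ad nn z≤n | no pn = pn refl
no-addable-cell-below-corner L₀ L₀' dr dc (suc p₀) v fs eq ad nn le | no pn with p₀ ≟ dr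
... | yes refl = nn (below dr dc)
... | no p₀n = <-irrefl refl (≤-trans (subst (_< rowCount p₀ L₀) eq ad)
                 (≤-trans (rowCount-antitone L₀ v (suc dr) p₀
                   (≤∧≢⇒< (≤-pred (≤∧≢⇒< le (λ e → pn (sym e)))) (λ e → p₀n (sym e))))
                          (corner-outer fs)))

transfers-second-moves-left : ∀ L₀ L₀' dr dc p q → Yamanouchi L₀ → RemovesCorner L₀ L₀' dr dc →
  rowCount p L₀ ≡ q → Addable p L₀ → ¬ Neighbour (dr , dc) (p , q) →
  Transfers (p , q) (dr , suc dc) (p , q) (dr , dc)
transfers-second-moves-left L₀ L₀' dr dc p q v fs eq ad nn =
  (λ { (a , b) → a , ≤-trans (n≤1+n dc) b }) , (λ { (a , b) → a , ≤∧≢⇒< (≤-pred b) (q≢dc a) })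
  where
  q≢dc : dr ≤ p → q ≢ dc
  q≢dc le refl = no-addable-cell-below-corner L₀ L₀' dr dc p v fs eq ad nn le

transfers-second-moves-up : ∀ L₀ L₀' dr dc p q → RemovesCorner L₀ L₀' dr dc →
  rowCount p L₀ ≡ q → ¬ Neighbour (dr , dc) (p , q) →
  Transfers (p , q) (suc dr , dc) (p , q) (dr , dc)
transfers-second-moves-up L₀ L₀' dr dc p q fs eq nn =
  (λ { (a , b) → ≤∧≢⇒< (≤-pred a) (non-neighbour⇒row≢ fs eq nn) , b }) ,
    (λ { (a , b) → ≤-trans (n≤1+n dr) a , b })

transfers-both-move : ∀ L₀ L₀' dr dc p q k zc → RemovesCorner L₀ L₀' dr dc →
  rowCount k (p ∷ L₀) ≡ zc → Addable k (p ∷ L₀) →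
  Neighbour (dr , dc) (p , q) → Neighbour (p , q) (k , zc) →
  Transfers (p , q) (k , zc) (dr , dc) (p , q)
transfers-both-move L₀ L₀' dr dc .dr .(suc dc) .dr .(suc (suc dc)) fs ez adk (right .dr .dc)
  (right .dr .(suc dc)) =
  (λ { (a , _) → ⊥-elim (<-irrefl refl a) }) , (λ _ → ≤-refl , n<1+n dc)
transfers-both-move L₀ L₀' dr dc .dr .(suc dc) .(suc dr) .(suc dc) fs ez adk (right .dr .dc)
  (below .dr .(suc dc)) =
  ⊥-elim (<-irrefl refl
    (≤-trans (≤-reflexive (sym (trans (sym (rowCount-≢ (suc dr) dr L₀ 1+n≢n)) ez))) (corner-outer fs)))
transfers-both-move L₀ L₀' dr dc .(suc dr) .dc .(suc dr) .(suc dc) fs ez adk (below .dr .dc)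
  (right .(suc dr) .dc) =
  ⊥-elim (<-irrefl refl
    (subst₂ _<_ ez (trans (rowCount-≢ dr (suc dr) L₀ (λ e → 1+n≢n (sym e))) (corner-row fs)) adk))
transfers-both-move L₀ L₀' dr dc .(suc dr) .dc .(suc (suc dr)) .dc fs ez adk (below .dr .dc)
  (below .(suc dr) .dc) =
  (λ _ → n<1+n dr , ≤-refl) , (λ { (a , _) → ⊥-elim (<-irrefl refl a) })

no-addable-cell-below-moved-corner : ∀ L₀ L₀' dr dc k → Yamanouchi L₀ → RemovesCorner L₀ L₀' dr dc →
  rowCount k (dr ∷ L₀) ≡ suc dc → Addable k (dr ∷ L₀) → ¬ Neighbour (dr , suc dc) (k , suc dc) → dr < k → ⊥
no-addable-cell-below-moved-corner L₀ L₀' dr dc (suc k₀) v fs ez adk nn (s≤s le) with k₀ ≟ dr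
... | yes refl = nn (below dr (suc dc))
... | no kn = <-irrefl refl (≤-trans (subst (_< rowCount k₀ L₀) ez adk)
                 (≤-trans (rowCount-antitone L₀ v (suc dr) k₀ (≤∧≢⇒< le (λ e → kn (sym e))))
                          (≤-trans (corner-outer fs) (n≤1+n dc))))

transfers-first-moves : ∀ L₀ L₀' dr dc p q k zc → Yamanouchi L₀ → RemovesCorner L₀ L₀' dr dc →
  rowCount k (p ∷ L₀) ≡ zc → Addable k (p ∷ L₀) → rowCount p L₀ ≡ q →
  Neighbour (dr , dc) (p , q) → ¬ Neighbour (p , q) (k , zc) →
  Transfers (p , q) (k , zc) (dr , dc) (k , zc)
transfers-first-moves L₀ L₀' dr dc .dr .(suc dc) k zc v fs ez adk eq (right .dr .dc) nn =
  (λ { (a , b) → a , zc≤dc a b }) , (λ { (a , b) → a , <-trans (n<1+n dc) b })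
  where
  zc≤dc : dr < k → zc ≤ suc dc → zc ≤ dc
  zc≤dc a b with m≤n⇒m<n∨m≡n b
  ... | inj₁ lt = ≤-pred lt
  ... | inj₂ refl = ⊥-elim (no-addable-cell-below-moved-corner L₀ L₀' dr dc k v fs ez adk nn a)
transfers-first-moves L₀ L₀' dr dc .(suc dr) .dc k zc v fs ez adk eq (below .dr .dc) nn =
  (λ { (a , b) → <-trans (n<1+n dr) a , b }) , (λ { (a , b) → k≤dr a , b })
  where
  k≤dr : k ≤ suc dr → k ≤ dr
  k≤dr a with m≤n⇒m<n∨m≡n a
  ... | inj₁ lt = ≤-pred lt
  ... | inj₂ refl = ⊥-elim (nn (subst (λ t → Neighbour (suc dr , dc) (suc dr , t))
                       (trans (cong suc (sym eq)) (trans (sym (rowCount-≡ (suc dr) L₀)) ez))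
                         (right (suc dr) dc)))

-- In the next lemmas (a1 , b1) and (a2 , b2) are the cells vacated by Δ and by Δ ∘ Δ on L,
-- and the new entry at (k , zc) may move into one of them.
no-addable-cell-below-removed-corner : ∀ L L₁ a1 b1 a2 → Yamanouchi L → RemovesCorner L L₁ a1 b1 →
  rowCount a2 L₁ ≡ b1 → rowCount a2 L ≡ b1 → Addable a2 L₁ → a1 ≤ a2 → ⊥
no-addable-cell-below-removed-corner L L₁ a1 b1 a2 v fs G1 ez ad le with a2 ≟ a1
... | yes refl = 1+n≢n (trans (sym (corner-row fs)) ez)
no-addable-cell-below-removed-corner L L₁ a1 b1 zero v fs G1 ez ad z≤n | no an = an refl
no-addable-cell-below-removed-corner L L₁ a1 b1 (suc a₀) v fs G1 ez ad le | no an with a₀ ≟ a1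
... | yes refl = <-irrefl refl (subst₂ _<_ G1 (removed-row fs) ad)
... | no a₀n = <-irrefl refl (≤-trans (subst (_< rowCount a₀ L₁) G1 ad)
                 (≤-trans (≤-reflexive (other-rows fs a₀ a₀n))
                 (≤-trans (rowCount-antitone L v (suc a1) a₀
                   (≤∧≢⇒< (≤-pred (≤∧≢⇒< le (λ e → an (sym e)))) (λ e → a₀n (sym e))))
                          (corner-outer fs))))

vacated-transfers-fills-second : ∀ L L₁ a1 b1 a2 b2 k zc → Yamanouchi L → RemovesCorner L L₁ a1 b1 →
  rowCount a2 L₁ ≡ suc b2 → rowCount k L ≡ zc → Addable k L₁ →
  ¬ Neighbour (a1 , b1) (k , zc) → Neighbour (a2 , b2) (k , zc) →
  Transfers (a2 , b2) (a1 , b1) (k , zc) (a1 , b1)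
vacated-transfers-fills-second L L₁ a1 b1 a2 b2 .a2 .(suc b2) v fs G1 ez ad nn (right .a2 .b2) =
  (λ { (x , y) → x , ≤-trans y (n≤1+n b2) }) ,
  λ { (x , y) → x , ≤∧≢⇒< y
    (λ e → no-addable-cell-below-removed-corner L L₁ a1 b1 a2 v fs (trans G1 e) (trans ez e) ad x) }
vacated-transfers-fills-second L L₁ a1 b1 a2 b2 .(suc a2) .b2 v fs G1 ez ad nn (below .a2 .b2) =
  (λ { (x , y) → ≤∧≢⇒< x (λ e → nn (subst₂ (λ t u → Neighbour (a1 , b1) (t , u)) (sym e)
                     (trans (sym (corner-row fs)) (subst (λ t → rowCount t L ≡ b2) e ez)) (right a1 b1))) ,
                       y }) ,
  λ { (x , y) → ≤-trans x (n≤1+n a2) , y }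

vacated-transfers-fills-first : ∀ L L₁ L₂ a1 b1 a2 b2 k zc → Yamanouchi L →
  RemovesCorner L L₁ a1 b1 → RemovesCorner L₁ L₂ a2 b2 →
  Neighbour (a1 , b1) (k , zc) → ¬ Neighbour (a2 , b2) (a1 , b1) →
  Transfers (a2 , b2) (a1 , b1) (a2 , b2) (k , zc)
vacated-transfers-fills-first L L₁ L₂ a1 b1 a2 b2 .a1 .(suc b1) v fs gs (right .a1 .b1) nn =
  (λ { (x , y) → x , ≤∧≢⇒< y (b1≢b2 x) }) , λ { (x , y) → x , ≤-trans y (n≤1+n b1) }
  where
  b1≢b2 : a2 < a1 → b1 ≢ b2
  b1≢b2 x refl with a1 ≟ suc a2
  ... | yes refl = nn (below a2 b1)
  ... | no an = <-irrefl refl (≤-trans (≤-trans (≤-reflexive (sym (corner-row fs)))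
                   (rowCount-antitone L v (suc a2) a1 x))
                   (≤-trans (≤-reflexive (sym (other-rows fs (suc a2) (λ e → an (sym e)))))
                     (corner-outer gs)))
vacated-transfers-fills-first L L₁ L₂ a1 b1 a2 b2 .(suc a1) .b1 v fs gs (below .a1 .b1) nn =
  (λ { (x , y) → ≤-trans x (n≤1+n a1) , y }) , λ { (x , y) → ≤∧≢⇒< x (a1≢a2 x y) , y }
  where
  a1≢a2 : a1 ≤ a2 → b2 < b1 → a1 ≢ a2
  a1≢a2 x y refl = nn (subst (λ t → Neighbour (a1 , b2) (a1 , t))
    (trans (sym (corner-row gs)) (removed-row fs)) (right a1 b2))

vacated-transfers-chain : ∀ L L₁ L₂ a1 b1 a2 b2 k zc → Addable k L → rowCount k L ≡ zc →
  RemovesCorner L L₁ a1 b1 → RemovesCorner L₁ L₂ a2 b2 →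
  Neighbour (a1 , b1) (k , zc) → Neighbour (a2 , b2) (a1 , b1) →
  Transfers (a2 , b2) (a1 , b1) (a1 , b1) (k , zc)
vacated-transfers-chain L L₁ L₂ .a2 .(suc b2) a2 b2 .a2 .(suc (suc b2)) ad ez fs gs (right .a2 .(suc b2))
  (right .a2 .b2) =
  (λ { (x , y) → ⊥-elim (<-irrefl refl x) }) , λ _ → ≤-refl , n<1+n (suc b2)
vacated-transfers-chain L L₁ L₂ .a2 .(suc b2) a2 b2 .(suc a2) .(suc b2) ad ez fs gs (below .a2 .(suc b2))
  (right .a2 .b2) =
  ⊥-elim (<-irrefl refl
    (≤-trans (≤-reflexive (trans (sym ez) (sym (other-rows fs (suc a2) 1+n≢n)))) (corner-outer gs)))
vacated-transfers-chain L L₁ L₂ .(suc a2) .b2 a2 b2 .(suc a2) .(suc b2) ad ez fs gs (right .(suc a2) .b2)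
  (below .a2 .b2) =
  ⊥-elim (<-irrefl refl
    (subst₂ _<_ ez (trans (sym (other-rows fs a2 (λ e → 1+n≢n (sym e)))) (corner-row gs)) ad))
vacated-transfers-chain L L₁ L₂ .(suc a2) .b2 a2 b2 .(suc (suc a2)) .b2 ad ez fs gs (below .(suc a2) .b2)
  (below .a2 .b2) =
  (λ _ → n<1+n (suc a2) , ≤-refl) , λ { (x , y) → ⊥-elim (<-irrefl refl x) }

vacated-step : ∀ k L L₁ a1 b1 L₂ a2 b2 → Yamanouchi L → Addable k L → RemovesCorner L L₁ a1 b1 →
  RemovesCorner L₁ L₂ a2 b2 →
  (∀ r → Δ (r ∷ L₁) ≡ Δ-step r (rowCount r L₁) L₂ (a2 , b2) (neighbour? (a2 , b2) (r , rowCount r L₁))) →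
  (D : Dec (Neighbour (a1 , b1) (k , rowCount k L))) →
    Yamanouchi (proj₁ (Δ-step k (rowCount k L) L₁ (a1 , b1) D)) →
  Transfers (a2 , b2) (a1 , b1) (Δcell (proj₁ (Δ-step k (rowCount k L) L₁ (a1 , b1) D)))
    (proj₂ (Δ-step k (rowCount k L) L₁ (a1 , b1) D))
vacated-step k L L₁ a1 b1 L₂ a2 b2 v ad fs gs eΔ (yes n1) v1 rewrite eΔ a1 | removed-row fs with neighbour?
  (a2 , b2) (a1 , b1)
... | yes n2 = vacated-transfers-chain L L₁ L₂ a1 b1 a2 b2 k (rowCount k L) ad refl fs gs n1 n2
... | no n2 = vacated-transfers-fills-first L L₁ L₂ a1 b1 a2 b2 k (rowCount k L) v fs gs n1 n2
vacated-step k L L₁ a1 b1 L₂ a2 b2 v ad fs gs eΔ (no n1) v1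
  rewrite eΔ k | other-rows fs k (non-neighbour⇒row≢ fs refl n1) with neighbour? (a2 , b2) (k , rowCount k L)
... | yes n2 = vacated-transfers-fills-second L L₁ a1 b1 a2 b2 k (rowCount k L) v fs (corner-row gs) refl
    (proj₁ v1) n1 n2
... | no n2 = transfers-refl

vacated-transfers : ∀ ks → Yamanouchi ks → 2 ≤ length ks →
  Transfers (cellOf ks 0) (cellOf ks 1) (Δcell (Δword ks)) (Δcell ks)
vacated-transfers [] v ()
vacated-transfers (k ∷ []) v (s≤s ())
vacated-transfers (zero ∷ zero ∷ []) v _ = (λ { (() , _) }) , λ _ → z≤n , s≤s z≤n
vacated-transfers (suc zero ∷ zero ∷ []) v _ = (λ _ → s≤s z≤n , z≤n) , λ { (() , _) }
vacated-transfers (suc (suc k) ∷ zero ∷ []) (() , _) _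
vacated-transfers (k ∷ suc k0 ∷ []) (_ , () , _) _
vacated-transfers (k ∷ x ∷ y ∷ rest) (ad , v) _ =
  subst₂ (λ p q → Transfers p q (Δcell (Δword (k ∷ L))) (Δcell (k ∷ L)))
    (sym (cellOf-earlier k L 0 (λ ()))) (sym (cellOf-earlier k L 1 (λ ())))
    (transfers-trans (vacated-transfers (x ∷ y ∷ rest) v (s≤s (s≤s z≤n)))
      (vacated-step k L (Δword L) (Δrow L) (Δcol L) (Δword L₁) (Δrow L₁) (Δcol L₁)
        v ad fsL (Δ-removesCorner′ L₁ (yamanouchi fsL) len1) (λ r → Δ-∷ r L₁ len1)
        (neighbour? (Δcell L) (k , rowCount k L)) (yamanouchi (Δ-removesCorner k L (ad , v)))))
  where
  L = x ∷ y ∷ rest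
  L₁ = Δword L
  fsL = Δ-removesCorner x (y ∷ rest) v
  len1 : length L₁ ≡ suc (length rest)
  len1 = suc-injective (one-shorter fsL)

newCell : (k zc : ℕ) (d : Cell) → Dec (Neighbour d (k , zc)) → Cell
newCell k zc d (yes _) = d
newCell k zc d (no _) = (k , zc)

Δ-step-word : ∀ k zc L d D → proj₁ (Δ-step k zc L d D) ≡ proj₁ (newCell k zc d D) ∷ L
Δ-step-word k zc L d (yes _) = refl
Δ-step-word k zc L d (no _) = refl

newCell-rowCount : ∀ k zc L L' dr dc → RemovesCorner L L' dr dc → rowCount k L ≡ zc →
  (D : Dec (Neighbour (dr , dc) (k , zc))) →
  rowCount (proj₁ (newCell k zc (dr , dc) D)) L' ≡ proj₂ (newCell k zc (dr , dc) D)
newCell-rowCount k zc L L' dr dc fs eq (yes _) = removed-row fs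
newCell-rowCount k zc L L' dr dc fs eq (no nn) = trans (other-rows fs k (non-neighbour⇒row≢ fs eq nn)) eq

Δ-top : ∀ k y rest i → let L = y ∷ rest in Yamanouchi (k ∷ L) → i ≡ length (Δword L) →
  cellOf (Δword (k ∷ L)) i ≡ newCell k (rowCount k L) (Δcell L) (neighbour? (Δcell L) (k , rowCount k L))
Δ-top k y rest i (ad , v) e =
  trans (cong (λ t → cellOf t i) (Δ-step-word k (rowCount k L) (Δword L) (Δcell L) D))
    (trans (cellOf-last _ (Δword L) i e)
           (cong (proj₁ (newCell k (rowCount k L) (Δcell L) D) ,_)
                 (newCell-rowCount k (rowCount k L) L (Δword L) _ _ (Δ-removesCorner y rest v) refl D)))
  where
  L = y ∷ rest
  D = neighbour? (Δcell L) (k , rowCount k L)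

Δ-step-transfers : ∀ k zc p q L₀ L₀' dr dc → Yamanouchi L₀ → Addable p L₀ → Addable k (p ∷ L₀) →
  RemovesCorner L₀ L₀' dr dc →
  rowCount p L₀ ≡ q → rowCount k (p ∷ L₀) ≡ zc →
  (D1 : Dec (Neighbour (dr , dc) (p , q))) →
    (D2 : Dec (Neighbour (proj₂ (Δ-step p q L₀' (dr , dc) D1)) (k , zc))) →
  Transfers (p , q) (k , zc) (newCell p q (dr , dc) D1)
    (newCell k zc (proj₂ (Δ-step p q L₀' (dr , dc) D1)) D2)
Δ-step-transfers .dr .(suc dc) p q L₀ L₀' dr dc v adp adk fs eq ez (no n1) (yes (right .dr .dc)) =
  transfers-second-moves-left L₀ L₀' dr dc p q v fs eq adp n1
Δ-step-transfers .(suc dr) .dc p q L₀ L₀' dr dc v adp adk fs eq ez (no n1) (yes (below .dr .dc)) =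
  transfers-second-moves-up L₀ L₀' dr dc p q fs eq n1
Δ-step-transfers k zc p q L₀ L₀' dr dc v adp adk fs eq ez (no n1) (no n2) = transfers-refl
Δ-step-transfers k zc p q L₀ L₀' dr dc v adp adk fs eq ez (yes n1) (yes n2) =
  transfers-both-move L₀ L₀' dr dc p q k zc fs ez adk n1 n2
Δ-step-transfers k zc p q L₀ L₀' dr dc v adp adk fs eq ez (yes n1) (no n2) =
  transfers-first-moves L₀ L₀' dr dc p q k zc v fs ez adk eq n1 n2

Δ-transfers-top : ∀ k x L₀ j → Yamanouchi (k ∷ x ∷ L₀) → length L₀ ≡ suc j →
  Transfers (cellOf (k ∷ x ∷ L₀) (suc j)) (cellOf (k ∷ x ∷ L₀) (suc (suc j)))
            (cellOf (Δword (k ∷ x ∷ L₀)) j) (cellOf (Δword (k ∷ x ∷ L₀)) (suc j))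
Δ-transfers-top k x [] j _ ()
Δ-transfers-top k x L₀@(y ∷ rest) j (ad , v@(adx , v₀)) e0 =
  transfers-subst
    (trans (cellOf-earlier k L (suc j) (λ q → 1+n≢n (sym (trans q (cong suc e0)))))
      (cellOf-last x L₀ (suc j) (sym e0)))
    (cellOf-last k L (suc (suc j)) (cong suc (sym e0)))
    (trans (cong (λ t → cellOf t j) (Δ-step-word k (rowCount k L) (Δword L) (Δcell L) D))
      (trans (cellOf-earlier _ (Δword L) j (λ q → 1+n≢n (sym (trans q lenL₁))))
        (Δ-top x y rest j v (sym lenL₀′))))
    (Δ-top k x L₀ (suc j) (ad , v) (sym lenL₁))
    (Δ-step-transfers k (rowCount k L) x (rowCount x L₀) L₀ (Δword L₀) (Δrow L₀) (Δcol L₀)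
       v₀ adx ad fs0 refl refl D₀ D)
  where
  L = x ∷ L₀
  D₀ = neighbour? (Δcell L₀) (x , rowCount x L₀)
  D = neighbour? (Δcell L) (k , rowCount k L)
  fs0 = Δ-removesCorner y rest v₀
  lenL₁ : length (Δword L) ≡ suc j
  lenL₁ = removesCorner-length (Δ-removesCorner x L₀ v) (cong suc e0)
  lenL₀′ : length (Δword L₀) ≡ j
  lenL₀′ = removesCorner-length fs0 e0

Δ-transfers-earlier : ∀ k x y rest j → Yamanouchi (k ∷ x ∷ y ∷ rest) → suc (suc j) < length (x ∷ y ∷ rest) →
  let L = x ∷ y ∷ rest in
  Transfers (cellOf L (suc j)) (cellOf L (suc (suc j))) (cellOf (Δword L) j) (cellOf (Δword L) (suc j)) →
  Transfers (cellOf (k ∷ L) (suc j)) (cellOf (k ∷ L) (suc (suc j)))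
            (cellOf (Δword (k ∷ L)) j) (cellOf (Δword (k ∷ L)) (suc j))
Δ-transfers-earlier k x y rest j (ad , v) lt tr =
  transfers-subst (cellOf-earlier k L (suc j) (λ q → <-irrefl q (<-trans (n<1+n (suc j)) lt)))
    (cellOf-earlier k L (suc (suc j)) (λ q → <-irrefl q lt))
    (trans (cong (λ t → cellOf t j) (Δ-step-word k (rowCount k L) (Δword L) (Δcell L) D))
           (cellOf-earlier _ (Δword L) j (λ q → <-irrefl q (<-trans (n<1+n j) lenj))))
    (trans (cong (λ t → cellOf t (suc j)) (Δ-step-word k (rowCount k L) (Δword L) (Δcell L) D))
           (cellOf-earlier _ (Δword L) (suc j) (λ q → <-irrefl q lenj)))
    tr
  where
  L = x ∷ y ∷ rest
  D = neighbour? (Δcell L) (k , rowCount k L)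
  lenj : suc j < length (Δword L)
  lenj = ≤-pred (subst (suc (suc (suc j)) ≤_) (sym (one-shorter (Δ-removesCorner x (y ∷ rest) v))) lt)

Δ-transfers : ∀ ks → Yamanouchi ks → ∀ j → suc (suc j) < length ks →
  Transfers (cellOf ks (suc j)) (cellOf ks (suc (suc j))) (cellOf (Δword ks) j) (cellOf (Δword ks) (suc j))
Δ-transfers [] v j ()
Δ-transfers (k ∷ []) v j (s≤s ())
Δ-transfers (k ∷ x ∷ []) v j (s≤s (s≤s ()))
Δ-transfers (k ∷ x ∷ y ∷ rest) v j lt =
  [ (λ lt′ → Δ-transfers-earlier k x y rest j v lt′ (Δ-transfers (x ∷ y ∷ rest) (proj₂ v) j lt′))
  , (λ e → Δ-transfers-top k x (y ∷ rest) j v (sym (suc-injective e))) ]′ (m≤n⇒m<n∨m≡n (≤-pred lt))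

-- The row-bumping lemma

insertRow-< : ∀ x r R → x < r → insertRow x (r ∷ R) ≡ (just r , x ∷ R)
insertRow-< x r R p rewrite <⇒<ᵇ≡true p = refl

insertRow-≥ : ∀ x r R → r ≤ x → insertRow x (r ∷ R) ≡ (proj₁ (insertRow x R) , r ∷ proj₂ (insertRow x R))
insertRow-≥ x r R p rewrite ≥⇒<ᵇ≡false p = refl

ColumnStrict : List ℕ → List ℕ → Set
ColumnStrict R [] = ⊤
ColumnStrict [] (s ∷ S) = ⊥
ColumnStrict (r ∷ R) (s ∷ S) = r < s × ColumnStrict R S

data IsTableau : Tableau → Set where
  tab-[] : IsTableau []
  tab-[_] : ∀ R → NonEmptyRow R → AllPairs _≤_ R → IsTableau (R ∷ [])
  tab-∷ : ∀ R S Ps → NonEmptyRow R → AllPairs _≤_ R → ColumnStrict R S → IsTableau (S ∷ Ps) →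
    IsTableau (R ∷ S ∷ Ps)

insertRow-bumps-larger : ∀ x R y → proj₁ (insertRow x R) ≡ just y → x < y
insertRow-bumps-larger x [] y ()
insertRow-bumps-larger x (r ∷ R) y e with x <? r
... | yes p rewrite insertRow-< x r R p with e
...   | refl = p
insertRow-bumps-larger x (r ∷ R) y e | no p rewrite insertRow-≥ x r R (≮⇒≥ p) = insertRow-bumps-larger x R y e

length-insertRow-bump : ∀ x R y → proj₁ (insertRow x R) ≡ just y → length (proj₂ (insertRow x R)) ≡ length R
length-insertRow-bump x [] y ()
length-insertRow-bump x (r ∷ R) y e with x <? r
... | yes p rewrite insertRow-< x r R p = refl
... | no p rewrite insertRow-≥ x r R (≮⇒≥ p) = cong suc (length-insertRow-bump x R y e)

length-insertRow-append : ∀ x R → proj₁ (insertRow x R) ≡ nothing →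
  length (proj₂ (insertRow x R)) ≡ suc (length R)
length-insertRow-append x [] e = refl
length-insertRow-append x (r ∷ R) e with x <? r
... | yes p rewrite insertRow-< x r R p with e
...   | ()
length-insertRow-append x (r ∷ R) e | no p rewrite insertRow-≥ x r R (≮⇒≥ p) =
  cong suc (length-insertRow-append x R e)

insertRow-append⇒all≤ : ∀ x R → proj₁ (insertRow x R) ≡ nothing → All (_≤ x) R
insertRow-append⇒all≤ x [] e = []
insertRow-append⇒all≤ x (r ∷ R) e with x <? r
... | yes p rewrite insertRow-< x r R p with e
...   | ()
insertRow-append⇒all≤ x (r ∷ R) e | no p rewrite insertRow-≥ x r R (≮⇒≥ p) =
  ≮⇒≥ p ∷ insertRow-append⇒all≤ x R e

all≤⇒insertRow-append : ∀ x R → All (_≤ x) R → proj₁ (insertRow x R) ≡ nothing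
all≤⇒insertRow-append x [] _ = refl
all≤⇒insertRow-append x (r ∷ R) (p ∷ ps) rewrite insertRow-≥ x r R p = all≤⇒insertRow-append x R ps

insertRow-append : ∀ x R → proj₁ (insertRow x R) ≡ nothing → proj₂ (insertRow x R) ≡ R ++ x ∷ []
insertRow-append x [] e = refl
insertRow-append x (r ∷ R) e with x <? r
... | yes p rewrite insertRow-< x r R p with e
...   | ()
insertRow-append x (r ∷ R) e | no p rewrite insertRow-≥ x r R (≮⇒≥ p) = cong (r ∷_) (insertRow-append x R e)

insertRow-nonEmpty : ∀ x R → NonEmptyRow (proj₂ (insertRow x R))
insertRow-nonEmpty x [] = tt
insertRow-nonEmpty x (r ∷ R) with x <? r
... | yes p rewrite insertRow-< x r R p = tt
... | no p rewrite insertRow-≥ x r R (≮⇒≥ p) = tt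

insertRow-bumped : ∀ x R y (P : ℕ → Set) → All P R → proj₁ (insertRow x R) ≡ just y → P y
insertRow-bumped x [] y P a ()
insertRow-bumped x (r ∷ R) y P (pr ∷ ps) e with x <? r
... | yes p rewrite insertRow-< x r R p with e
...   | refl = pr
insertRow-bumped x (r ∷ R) y P (pr ∷ ps) e | no p rewrite insertRow-≥ x r R (≮⇒≥ p) =
  insertRow-bumped x R y P ps e

insertRow-all : ∀ x R (P : ℕ → Set) → All P R → P x → All P (proj₂ (insertRow x R))
insertRow-all x [] P a px = px ∷ []
insertRow-all x (r ∷ R) P (pr ∷ ps) px with x <? r
... | yes p rewrite insertRow-< x r R p = px ∷ ps
... | no p rewrite insertRow-≥ x r R (≮⇒≥ p) = pr ∷ insertRow-all x R P ps px

insertRow-weaklyIncreasing : ∀ x R → AllPairs _≤_ R → AllPairs _≤_ (proj₂ (insertRow x R))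
insertRow-weaklyIncreasing x [] _ = [] ∷ []
insertRow-weaklyIncreasing x (r ∷ R) (a ∷ s) with x <? r
... | yes p rewrite insertRow-< x r R p = All.map (≤-trans (<⇒≤ p)) a ∷ s
... | no p rewrite insertRow-≥ x r R (≮⇒≥ p) =
    insertRow-all x R (r ≤_) a (≮⇒≥ p) ∷ insertRow-weaklyIncreasing x R s

insertRow-smaller-bumps≤ : ∀ x y R → y < x →
  Σ ℕ (λ y' → proj₁ (insertRow y (proj₂ (insertRow x R))) ≡ just y' × y' ≤ x)
insertRow-smaller-bumps≤ x y [] lt rewrite insertRow-< y x [] lt = x , refl , ≤-refl
insertRow-smaller-bumps≤ x y (r ∷ R) lt with x <? r
... | yes p rewrite insertRow-< x r R p | insertRow-< y x R lt = x , refl , ≤-refl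
... | no p rewrite insertRow-≥ x r R (≮⇒≥ p) with y <? r
...   | yes q rewrite insertRow-< y r (proj₂ (insertRow x R)) q = r , refl , ≮⇒≥ p
...   | no q rewrite insertRow-≥ y r (proj₂ (insertRow x R)) (≮⇒≥ q) = insertRow-smaller-bumps≤ x y R lt

insertRow-bumps-monotone : ∀ x y R → x ≤ y → AllPairs _≤_ R → ∀ x' y' → proj₁ (insertRow x R) ≡ just x' →
  proj₁ (insertRow y (proj₂ (insertRow x R))) ≡ just y' → x' ≤ y'
insertRow-bumps-monotone x y [] le s x' y' () e2
insertRow-bumps-monotone x y (r ∷ R) le (a ∷ s) x' y' e1 e2 with x <? r
... | yes p rewrite insertRow-< x r R p | insertRow-≥ y x R le with e1
...   | refl = insertRow-bumped y R y' (r ≤_) a e2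
insertRow-bumps-monotone x y (r ∷ R) le (a ∷ s) x' y' e1 e2 | no p rewrite insertRow-≥ x r R (≮⇒≥ p)
      | insertRow-≥ y r (proj₂ (insertRow x R)) (≤-trans (≮⇒≥ p) le) =
        insertRow-bumps-monotone x y R le s x' y' e1 e2

columnStrict-length : ∀ R S → ColumnStrict R S → length S ≤ length R
columnStrict-length R [] _ = z≤n
columnStrict-length [] (s ∷ S) ()
columnStrict-length (r ∷ R) (s ∷ S) (_ , b) = s≤s (columnStrict-length R S b)

columnStrict-insertRow-upper : ∀ x R S y → ColumnStrict R S → proj₁ (insertRow x R) ≡ just y →
  ColumnStrict (proj₂ (insertRow x R)) S
columnStrict-insertRow-upper x R [] y b e = tt
columnStrict-insertRow-upper x [] (s ∷ S) y () e
columnStrict-insertRow-upper x (r ∷ R) (s ∷ S) y (lt , b) e with x <? r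
... | yes p rewrite insertRow-< x r R p = <-trans p lt , b
... | no p rewrite insertRow-≥ x r R (≮⇒≥ p) = lt , columnStrict-insertRow-upper x R S y b e

columnStrict-insertRow-bump : ∀ x R S y → ColumnStrict R S → proj₁ (insertRow x R) ≡ just y →
  ColumnStrict (proj₂ (insertRow x R)) (proj₂ (insertRow y S))
columnStrict-insertRow-bump x [] S y b ()
columnStrict-insertRow-bump x (r ∷ R) [] y b e with x <? r
... | yes p rewrite insertRow-< x r R p with e
...   | refl = p , tt
columnStrict-insertRow-bump x (r ∷ R) [] y b e | no p rewrite insertRow-≥ x r R (≮⇒≥ p) =
  ≤-<-trans (≮⇒≥ p) (insertRow-bumps-larger x R y e) , tt
columnStrict-insertRow-bump x (r ∷ R) (s ∷ S) y (lt , b) e with x <? r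
... | yes p rewrite insertRow-< x r R p with e
...   | refl rewrite insertRow-< r s S lt = p , b
columnStrict-insertRow-bump x (r ∷ R) (s ∷ S) y (lt , b) e | no p rewrite insertRow-≥ x r R (≮⇒≥ p)
  with y <? s
...   | yes q rewrite insertRow-< y s S q = ≤-<-trans (≮⇒≥ p) (insertRow-bumps-larger x R y e) ,
    columnStrict-insertRow-upper x R S y b e
...   | no q rewrite insertRow-≥ y s S (≮⇒≥ q) = lt , columnStrict-insertRow-bump x R S y b e

columnStrict-snoc : ∀ R S x → ColumnStrict R S → ColumnStrict (R ++ x ∷ []) S
columnStrict-snoc R [] x b = tt
columnStrict-snoc [] (s ∷ S) x ()
columnStrict-snoc (r ∷ R) (s ∷ S) x (lt , b) = lt , columnStrict-snoc R S x b

columnStrict-insertRow-append : ∀ x R S → ColumnStrict R S → proj₁ (insertRow x R) ≡ nothing →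
  ColumnStrict (proj₂ (insertRow x R)) S
columnStrict-insertRow-append x R S b e rewrite insertRow-append x R e = columnStrict-snoc R S x b

bump-appended⇒shorter : ∀ x R S y → ColumnStrict R S → proj₁ (insertRow x R) ≡ just y →
  proj₁ (insertRow y S) ≡ nothing → length S < length R
bump-appended⇒shorter x [] S y b () e2
bump-appended⇒shorter x (r ∷ R) [] y b e e2 = s≤s z≤n
bump-appended⇒shorter x (r ∷ R) (s ∷ S) y (lt , b) e e2 with x <? r
... | yes p rewrite insertRow-< x r R p with e
...   | refl rewrite insertRow-< r s S lt with e2
...     | ()
bump-appended⇒shorter x (r ∷ R) (s ∷ S) y (lt , b) e e2 | no p rewrite insertRow-≥ x r R (≮⇒≥ p) with y <? s
...   | yes q rewrite insertRow-< y s S q with e2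
...     | ()
bump-appended⇒shorter x (r ∷ R) (s ∷ S) y (lt , b) e e2 | no p | no q rewrite insertRow-≥ y s S (≮⇒≥ q) =
  s≤s (bump-appended⇒shorter x R S y b e e2)

rowInsert-append : ∀ x R Ps → proj₁ (insertRow x R) ≡ nothing →
  rowInsert x (R ∷ Ps) ≡ ((proj₂ (insertRow x R) ∷ Ps) , 0)
rowInsert-append x R Ps e with insertRow x R | e
... | (nothing , r′) | refl = refl

rowInsert-bump : ∀ x R Ps y → proj₁ (insertRow x R) ≡ just y →
  rowInsert x (R ∷ Ps) ≡ ((proj₂ (insertRow x R) ∷ proj₁ (rowInsert y Ps)) , suc (proj₂ (rowInsert y Ps)))
rowInsert-bump x R Ps y e with insertRow x R | e
... | (just .y , r′) | refl = refl

ColumnStrictHead : List ℕ → Tableau → Set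
ColumnStrictHead R [] = ⊤
ColumnStrictHead R (S ∷ _) = ColumnStrict R S

isTableau-∷ : ∀ R Ps → NonEmptyRow R → AllPairs _≤_ R → ColumnStrictHead R Ps → IsTableau Ps →
  IsTableau (R ∷ Ps)
isTableau-∷ R [] ne s b t = tab-[_] R ne s
isTableau-∷ R (S ∷ Ps) ne s b t = tab-∷ R S Ps ne s b t

isTableau-tail : ∀ R Ps → IsTableau (R ∷ Ps) → IsTableau Ps
isTableau-tail R [] _ = tab-[]
isTableau-tail R (S ∷ Ps) (tab-∷ .R .S .Ps _ _ _ t) = t

isTableau-head : ∀ R Ps → IsTableau (R ∷ Ps) → NonEmptyRow R × AllPairs _≤_ R × ColumnStrictHead R Ps
isTableau-head R [] (tab-[_] .R ne s) = ne , s , tt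
isTableau-head R (S ∷ Ps) (tab-∷ .R .S .Ps ne s b t) = ne , s , b

columnStrictHead-bump : ∀ R x y Ps → ColumnStrictHead R Ps → proj₁ (insertRow x R) ≡ just y →
  ColumnStrictHead (proj₂ (insertRow x R)) (proj₁ (rowInsert y Ps))
columnStrictHead-bump R x y [] b e = columnStrict-insertRow-bump x R [] y tt e
columnStrictHead-bump R x y (S ∷ Ps) b e with proj₁ (insertRow y S) in e2
... | nothing rewrite rowInsert-append y S Ps e2 = columnStrict-insertRow-bump x R S y b e
... | just z rewrite rowInsert-bump y S Ps z e2 = columnStrict-insertRow-bump x R S y b e

columnStrictHead-append : ∀ x R Ps → ColumnStrictHead R Ps → proj₁ (insertRow x R) ≡ nothing →
  ColumnStrictHead (proj₂ (insertRow x R)) Ps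
columnStrictHead-append x R [] b e = tt
columnStrictHead-append x R (S ∷ Ps) b e = columnStrict-insertRow-append x R S b e

bump-appended-addable : ∀ x R Ps y → NonEmptyRow R → ColumnStrictHead R Ps → proj₁ (insertRow x R) ≡ just y →
  proj₂ (rowInsert y Ps) ≡ 0 → rowLength 0 Ps < length R
bump-appended-addable x (r ∷ R) [] y ne b e q = s≤s z≤n
bump-appended-addable x [] Ps y () b e q
bump-appended-addable x R (S ∷ Ps) y ne b e q with proj₁ (insertRow y S) in e2
... | nothing = bump-appended⇒shorter x R S y b e e2
... | just z rewrite rowInsert-bump y S Ps z e2 with q
...   | ()

record RowInsertSpec (P P′ : Tableau) (k : ℕ) : Set where
  field
    isTableau : IsTableau P′
    rowLength-other : ∀ r → r ≢ k → rowLength r P′ ≡ rowLength r P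
    rowLength-new : rowLength k P′ ≡ suc (rowLength k P)
    new-addable : ∀ k' → k ≡ suc k' → rowLength (suc k') P < rowLength k' P

RowInsertSpecOf : ℕ → Tableau → Set
RowInsertSpecOf x P = RowInsertSpec P (proj₁ (rowInsert x P)) (proj₂ (rowInsert x P))

rowInsert-spec : ∀ x P → IsTableau P → RowInsertSpecOf x P
rowInsert-spec x [] t = record
  { isTableau = tab-[_] (x ∷ []) tt ([] ∷ [])
  ; rowLength-other = other
  ; rowLength-new = refl
  ; new-addable = λ k' () }
  where
  other : ∀ r → r ≢ 0 → rowLength r ((x ∷ []) ∷ []) ≡ 0
  other zero n = ⊥-elim (n refl)
  other (suc r) n = refl
rowInsert-spec x (R ∷ Ps) t with proj₁ (insertRow x R) in e
... | nothing rewrite rowInsert-append x R Ps e = record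
  { isTableau = isTableau-∷ _ Ps (insertRow-nonEmpty x R) (insertRow-weaklyIncreasing x R (proj₁ (proj₂ hd)))
                  (columnStrictHead-append x R Ps (proj₂ (proj₂ hd)) e) (isTableau-tail R Ps t)
  ; rowLength-other = other
  ; rowLength-new = length-insertRow-append x R e
  ; new-addable = λ k' () }
  where
  hd = isTableau-head R Ps t
  other : ∀ r → r ≢ 0 → rowLength r (proj₂ (insertRow x R) ∷ Ps) ≡ rowLength r (R ∷ Ps)
  other zero n = ⊥-elim (n refl)
  other (suc r) n = refl
... | just y rewrite rowInsert-bump x R Ps y e = record
  { isTableau = isTableau-∷ _ _ (insertRow-nonEmpty x R) (insertRow-weaklyIncreasing x R (proj₁ (proj₂ hd)))
                  (columnStrictHead-bump R x y Ps (proj₂ (proj₂ hd)) e) (RowInsertSpec.isTableau ih)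
  ; rowLength-other = other
  ; rowLength-new = RowInsertSpec.rowLength-new ih
  ; new-addable = addable }
  where
  hd = isTableau-head R Ps t
  ih = rowInsert-spec y Ps (isTableau-tail R Ps t)
  other : ∀ r → r ≢ suc (proj₂ (rowInsert y Ps)) →
    rowLength r (proj₂ (insertRow x R) ∷ proj₁ (rowInsert y Ps)) ≡ rowLength r (R ∷ Ps)
  other zero n = length-insertRow-bump x R y e
  other (suc r) n = RowInsertSpec.rowLength-other ih r (λ q → n (cong suc q))
  addable : ∀ k' → suc (proj₂ (rowInsert y Ps)) ≡ suc k' → rowLength (suc k') (R ∷ Ps) < rowLength k' (R ∷ Ps)
  addable zero q = bump-appended-addable x R Ps y (proj₁ hd) (proj₂ (proj₂ hd)) e (suc-injective q)
  addable (suc k'') q = RowInsertSpec.new-addable ih k'' (suc-injective q)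

rowLength≤head : ∀ R Ps → IsTableau (R ∷ Ps) → ∀ r → rowLength r Ps ≤ length R
rowLength≤head R [] t r = z≤n
rowLength≤head R (S ∷ Ps) (tab-∷ .R .S .Ps ne s b t) zero = columnStrict-length R S b
rowLength≤head R (S ∷ Ps) (tab-∷ .R .S .Ps ne s b t) (suc r) =
  ≤-trans (rowLength≤head S Ps t r) (columnStrict-length R S b)

rowLength≤rowLength0 : ∀ P → IsTableau P → ∀ r → rowLength r P ≤ rowLength 0 P
rowLength≤rowLength0 [] t r = z≤n
rowLength≤rowLength0 (R ∷ Ps) t zero = ≤-refl
rowLength≤rowLength0 (R ∷ Ps) t (suc r) = rowLength≤head R Ps t r

insertionCell : ℕ → Tableau → Cell
insertionCell x P = proj₂ (rowInsert x P) , rowLength (proj₂ (rowInsert x P)) P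

RecordsDescent : ℕ → ℕ → Cell → Cell → Set
RecordsDescent x y c d = (y < x → Descent c d) × (x ≤ y → Ascent c d)

row-bumping : ∀ x y P → IsTableau P →
  RecordsDescent x y (insertionCell x P) (insertionCell y (proj₁ (rowInsert x P)))
row-bumping x y [] t with y <? x
... | yes p rewrite insertRow-< y x [] p = (λ _ → s≤s z≤n , z≤n) , (λ le → ⊥-elim (<⇒≱ p le))
... | no p rewrite insertRow-≥ y x [] (≮⇒≥ p) = (λ q → ⊥-elim (p q)) , (λ _ → z≤n , s≤s z≤n)
row-bumping x y (R ∷ Ps) t with proj₁ (insertRow x R) in e1
... | nothing rewrite rowInsert-append x R Ps e1 = desc , asc
  where
  asc : x ≤ y → Ascent (0 , length R) (insertionCell y (proj₂ (insertRow x R) ∷ Ps))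
  asc le rewrite rowInsert-append y (proj₂ (insertRow x R)) Ps
                   (all≤⇒insertRow-append y _
                     (insertRow-all x R (_≤ y) (All.map (λ q → ≤-trans q le) (insertRow-append⇒all≤ x R e1))
                       le))
    = z≤n , ≤-reflexive (sym (length-insertRow-append x R e1))
  desc : y < x → Descent (0 , length R) (insertionCell y (proj₂ (insertRow x R) ∷ Ps))
  desc lt with insertRow-smaller-bumps≤ x y R lt
  ... | y' , e2 , _ rewrite rowInsert-bump y (proj₂ (insertRow x R)) Ps y' e2 =
    s≤s z≤n , rowLength≤head R Ps t (proj₂ (rowInsert y' Ps))
... | just x' rewrite rowInsert-bump x R Ps x' e1 = desc , asc
  where
  Ps1 = proj₁ (rowInsert x' Ps)
  k1′ = proj₂ (rowInsert x' Ps)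
  R1 = proj₂ (insertRow x R)
  tPs = isTableau-tail R Ps t
  sp = rowInsert-spec x (R ∷ Ps) t
  asc : x ≤ y → Ascent (suc k1′ , rowLength k1′ Ps) (insertionCell y (R1 ∷ Ps1))
  asc le with proj₁ (insertRow y R1) in e2
  ... | nothing rewrite rowInsert-append y R1 Ps1 e2 =
    z≤n , subst (rowLength k1′ Ps <_) (sym (length-insertRow-bump x R x' e1))
            (<-≤-trans (RowInsertSpec.new-addable sp k1′ (cong proj₂ (rowInsert-bump x R Ps x' e1)))
              (rowLength≤rowLength0 (R ∷ Ps) t k1′))
  ... | just y' rewrite rowInsert-bump y R1 Ps1 y' e2 with proj₂ (row-bumping x' y' Ps tPs)
      (insertRow-bumps-monotone x y R le (proj₁ (proj₂ (isTableau-head R Ps t))) x' y' e1 e2)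
  ...   | (a , b) = s≤s a , b
  desc : y < x → Descent (suc k1′ , rowLength k1′ Ps) (insertionCell y (R1 ∷ Ps1))
  desc lt with insertRow-smaller-bumps≤ x y R lt
  ... | y' , e2 , le2 rewrite rowInsert-bump y R1 Ps1 y' e2 with proj₁ (row-bumping x' y' Ps tPs)
      (≤-<-trans le2 (insertRow-bumps-larger x R x' e1))
  ...   | (a , b) = s≤s a , b

recordingWord : List ℕ → Tableau → List ℕ → List ℕ
recordingWord [] P acc = acc
recordingWord (x ∷ xs) P acc = recordingWord xs (proj₁ (rowInsert x P)) (proj₂ (rowInsert x P) ∷ acc)

rsFrom-recording : ∀ xs P acc →
  proj₂ (rsFrom (suc (length acc)) xs (P , fill 1 acc)) ≡ fill 1 (recordingWord xs P acc)
rsFrom-recording [] P acc = refl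
rsFrom-recording (x ∷ xs) P acc = rsFrom-recording xs (proj₁ (rowInsert x P)) (proj₂ (rowInsert x P) ∷ acc)

RS-recording : ∀ xs → proj₂ (RS xs) ≡ fill 1 (recordingWord xs [] [])
RS-recording xs = rsFrom-recording xs [] []

RSInvariant : Tableau → List ℕ → Set
RSInvariant P acc = IsTableau P × Yamanouchi acc × (∀ r → rowLength r P ≡ rowCount r acc)

rsInvariant-step : ∀ x P acc → RSInvariant P acc →
  RSInvariant (proj₁ (rowInsert x P)) (proj₂ (rowInsert x P) ∷ acc)
rsInvariant-step x P acc (t , v , rl) = RowInsertSpec.isTableau sp , (addable k (RowInsertSpec.new-addable sp) , v) , rows
  where
  sp = rowInsert-spec x P t
  k = proj₂ (rowInsert x P)
  addable : ∀ k → (∀ k' → k ≡ suc k' → rowLength (suc k') P < rowLength k' P) → Addable k acc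
  addable zero h = tt
  addable (suc k') h = subst₂ _<_ (rl (suc k')) (rl k') (h k' refl)
  rows : ∀ r → rowLength r (proj₁ (rowInsert x P)) ≡ rowCount r (k ∷ acc)
  rows r with r ≟ k
  ... | yes refl = trans (RowInsertSpec.rowLength-new sp) (cong suc (rl r))
  ... | no n = trans (RowInsertSpec.rowLength-other sp r n) (rl r)

rsInvariant-[] : RSInvariant [] []
rsInvariant-[] = tab-[] , tt , λ r → refl

recordingWord-yamanouchi : ∀ xs P acc → RSInvariant P acc → Yamanouchi (recordingWord xs P acc)
recordingWord-yamanouchi [] P acc (t , v , rl) = v
recordingWord-yamanouchi (x ∷ xs) P acc iv = recordingWord-yamanouchi xs _ _ (rsInvariant-step x P acc iv)

length-recordingWord : ∀ xs P acc → length (recordingWord xs P acc) ≡ length xs + length acc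
length-recordingWord [] P acc = refl
length-recordingWord (x ∷ xs) P acc = trans (length-recordingWord xs _ _) (+-suc (length xs) (length acc))

cellOf-recordingWord : ∀ xs P acc i → i < length acc → cellOf (recordingWord xs P acc) i ≡ cellOf acc i
cellOf-recordingWord [] P acc i lt = refl
cellOf-recordingWord (x ∷ xs) P acc i lt =
  trans (cellOf-recordingWord xs _ _ i (≤-trans lt (n≤1+n _))) (cellOf-earlier _ acc i (λ q → <-irrefl q lt))

nth : List ℕ → ℕ → ℕ
nth [] _ = 0
nth (x ∷ xs) zero = x
nth (x ∷ xs) (suc i) = nth xs i

recording-transfers : ∀ xs P acc → RSInvariant P acc → ∀ j → suc j < length xs →
  let K = recordingWord xs P acc in
  RecordsDescent (nth xs j) (nth xs (suc j)) (cellOf K (length acc + j)) (cellOf K (suc (length acc + j)))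
recording-transfers [] P acc iv j ()
recording-transfers (x ∷ []) P acc iv j (s≤s ())
recording-transfers (x ∷ y ∷ rest) P acc iv@(t , _ , rl) zero lt =
  subst₂ (RecordsDescent x y) (sym c1) (sym c2) (row-bumping x y P t)
  where
  P1 = proj₁ (rowInsert x P)
  k1 = proj₂ (rowInsert x P)
  P2 = proj₁ (rowInsert y P1)
  k2 = proj₂ (rowInsert y P1)
  acc2 = k2 ∷ k1 ∷ acc
  K = recordingWord (x ∷ y ∷ rest) P acc
  c1 : cellOf K (length acc + 0) ≡ (k1 , rowLength k1 P)
  c1 = trans (cong (cellOf K) (+-identityʳ (length acc)))
       (trans (cellOf-recordingWord rest P2 acc2 (length acc) (≤-trans (n<1+n _) (n≤1+n _)))
       (trans (cellOf-earlier k2 (k1 ∷ acc) (length acc) (λ q → 1+n≢n (sym q)))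
       (trans (cellOf-last k1 acc (length acc) refl) (cong (k1 ,_) (sym (rl k1))))))
  c2 : cellOf K (suc (length acc + 0)) ≡ (k2 , rowLength k2 P1)
  c2 = trans (cong (λ t → cellOf K (suc t)) (+-identityʳ (length acc)))
       (trans (cellOf-recordingWord rest P2 acc2 (suc (length acc)) (n<1+n _))
       (trans (cellOf-last k2 (k1 ∷ acc) (suc (length acc)) refl)
              (cong (k2 ,_) (sym (proj₂ (proj₂ (rsInvariant-step x P acc iv)) k2)))))
recording-transfers (x ∷ y ∷ rest) P acc iv (suc j) (s≤s lt) =
  subst (λ t → RecordsDescent (nth (y ∷ rest) j) (nth (y ∷ rest) (suc j)) (cellOf K t) (cellOf K (suc t)))
        (sym (+-suc (length acc) j))
        (recording-transfers (y ∷ rest) (proj₁ (rowInsert x P)) (proj₂ (rowInsert x P) ∷ acc)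
          (rsInvariant-step x P acc iv) j lt)
  where
  K = recordingWord (x ∷ y ∷ rest) P acc

-- Evacuation

evLoop-slide : ∀ k T E T' r c → slide (size T) 0 0 T ≡ (T' , (r , c)) →
  evLoop (suc k) T E ≡ evLoop k T' (set r c (suc k) E)
evLoop-slide k T E T' r c eq rewrite eq = refl

evacuate : ℕ → List ℕ → Tableau → Tableau
evacuate zero ks E = E
evacuate (suc k) ks E = evacuate k (Δword ks) (set (Δrow ks) (Δcol ks) (suc k) E)

evLoop≡evacuate : ∀ k a ks E → Yamanouchi ks → length ks ≡ k → evLoop k (fill a ks) E ≡ evacuate k ks E
evLoop≡evacuate zero a ks E v e = refl
evLoop≡evacuate (suc k) a [] E v ()
evLoop≡evacuate (suc k) a (k0 ∷ ks) E v e =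
  trans (evLoop-slide k (fill a (k0 ∷ ks)) E _ _ _ (slide-fill a k0 ks v))
        (evLoop≡evacuate k (suc a) _ _ (yamanouchi fs) (removesCorner-length fs e))
  where
  fs = Δ-removesCorner k0 ks v

evCell : ℕ → List ℕ → ℕ → Cell
evCell zero ks L = (0 , 0)
evCell (suc k) ks L with L ≟ suc k
... | yes _ = Δcell ks
... | no _ = evCell k (Δword ks) L

evCell-top : ∀ k ks → evCell (suc k) ks (suc k) ≡ Δcell ks
evCell-top k ks with suc k ≟ suc k
... | yes _ = refl
... | no n = ⊥-elim (n refl)

evCell-below : ∀ k ks L → L ≢ suc k → evCell (suc k) ks L ≡ evCell k (Δword ks) L
evCell-below k ks L ne with L ≟ suc k
... | yes e = ⊥-elim (ne e)
... | no _ = refl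

evacuate-cases : ∀ k ks E x y →
  (Σ ℕ λ L → 1 ≤ L × L ≤ k × (x , y) ≡ evCell k ks L × get x y (evacuate k ks E) ≡ just L)
  ⊎ (get x y (evacuate k ks E) ≡ get x y E)
evacuate-cases zero ks E x y = inj₂ refl
evacuate-cases (suc k) ks E x y with evacuate-cases k (Δword ks) (set dr dc (suc k) E) x y
  where
  dr = Δrow ks
  dc = Δcol ks
... | inj₁ (L , a , b , c , g) =
  inj₁ (L , a , ≤-trans b (n≤1+n k) , trans c (sym (evCell-below k ks L (λ q → <-irrefl q (s≤s b)))) , g)
... | inj₂ g with (x , y) ≟ᶜ (Δrow ks , Δcol ks)
...   | no n = inj₂ (trans g (get-set-≢ _ _ (suc k) E x y n))
...   | yes refl with Δcol ks <? rowLength (Δrow ks) E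
...     | yes lt = inj₁ (suc k , s≤s z≤n , ≤-refl , sym (evCell-top k ks) , trans g (get-set-≡ _ _ (suc k) E lt))
...     | no nlt = inj₂ (trans g (trans (get-set-nothing _ _ (suc k) E _ _ (get-≥⇒nothing _ _ E (≮⇒≥ nlt)))
                                      (sym (get-≥⇒nothing _ _ E (≮⇒≥ nlt)))))

InShape : List ℕ → Cell → Set
InShape ks (r , c) = c < rowCount r ks

getCell : Cell → Tableau → Maybe ℕ
getCell x T = get (proj₁ x) (proj₂ x) T

inShape-removed : ∀ ks ks₁ dr dc → RemovesCorner ks ks₁ dr dc → ∀ x → InShape ks₁ x → InShape ks x
inShape-removed ks ks₁ dr dc fs (r , c) lt with r ≟ dr
... | yes refl = subst (c <_) (sym (corner-row fs))
    (≤-trans lt (≤-trans (≤-reflexive (removed-row fs)) (n≤1+n dc)))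
... | no n = subst (c <_) (other-rows fs r n) lt

corner∉removed : ∀ ks ks₁ dr dc → RemovesCorner ks ks₁ dr dc → ¬ InShape ks₁ (dr , dc)
corner∉removed ks ks₁ dr dc fs lt = <-irrefl (sym (removed-row fs)) lt

corner∈ : ∀ ks ks₁ dr dc → RemovesCorner ks ks₁ dr dc → InShape ks (dr , dc)
corner∈ ks ks₁ dr dc fs = ≤-reflexive (sym (corner-row fs))

evCell-inShape : ∀ k ks → Yamanouchi ks → length ks ≡ k → ∀ L → 1 ≤ L → L ≤ k → InShape ks (evCell k ks L)
evCell-inShape zero ks v e L a b = ⊥-elim (<-irrefl refl (≤-trans a b))
evCell-inShape (suc k) ks v e L a b with L ≟ suc k
... | yes refl = corner∈ ks _ _ _ fs
  where fs = Δ-removesCorner′ ks v e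
... | no n = inShape-removed ks _ _ _ fs _
    (evCell-inShape k _ (yamanouchi fs) (removesCorner-length fs e) L a
                 (≤-pred (≤∧≢⇒< b n)))
  where fs = Δ-removesCorner′ ks v e

evacuate-evCell : ∀ k ks E → Yamanouchi ks → length ks ≡ k →
  (∀ r c → InShape ks (r , c) → c < rowLength r E) → ∀ L → 1 ≤ L → L ≤ k →
  getCell (evCell k ks L) (evacuate k ks E) ≡ just L
evacuate-evCell zero ks E v e h L a b = ⊥-elim (<-irrefl refl (≤-trans a b))
evacuate-evCell (suc k) ks E v e h L a b with L ≟ suc k
... | yes refl with evacuate-cases k (Δword ks) E′ (Δrow ks) (Δcol ks)
  where
  E′ = set (Δrow ks) (Δcol ks) (suc k) E
...   | inj₁ (L′ , a′ , b′ , c′ , g′) =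
    ⊥-elim (corner∉removed ks _ _ _ fs (subst (InShape (Δword ks)) (sym c′)
                                       (evCell-inShape k _ (yamanouchi fs)
                                         (removesCorner-length fs e) L′ a′ b′)))
  where fs = Δ-removesCorner′ ks v e
...   | inj₂ g = trans g (get-set-≡ _ _ (suc k) E (h _ _ (corner∈ ks _ _ _ fs)))
  where fs = Δ-removesCorner′ ks v e
evacuate-evCell (suc k) ks E v e h L a b | no n =
  evacuate-evCell k (Δword ks) _ (yamanouchi fs) (removesCorner-length fs e) h′ L a
    (≤-pred (≤∧≢⇒< b n))
  where
  fs = Δ-removesCorner′ ks v e
  h′ : ∀ r c → InShape (Δword ks) (r , c) → c < rowLength r (set (Δrow ks) (Δcol ks) (suc k) E)
  h′ r c i = subst (c <_) (sym (rowLength-set _ _ (suc k) E r))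
    (h r c (inShape-removed ks _ _ _ fs (r , c) i))

Σ[1…] : (ℕ → ℕ) → ℕ → ℕ
Σ[1…] g zero = 0
Σ[1…] g (suc k) = g (suc k) + Σ[1…] g k

entrySum : (ℕ → ℕ) → Tableau → ℕ
entrySum g E = sum (map sum (map (map g) E))

entrySumL-setL : ∀ g c w v xs → getL c xs ≡ just v → sum (map g (setL c w xs)) + g v ≡ sum (map g xs) + g w
entrySumL-setL g c w v [] ()
entrySumL-setL g zero w v (x ∷ xs) refl = xy∙z≈zy∙x (g w) _ (g x)
entrySumL-setL g (suc c) w v (x ∷ xs) e =
  trans (+-assoc (g x) _ (g v))
    (trans (cong (g x +_) (entrySumL-setL g c w v xs e)) (sym (+-assoc (g x) _ (g w))))

entrySum-set : ∀ g r c w v E → get r c E ≡ just v → entrySum g (set r c w E) + g v ≡ entrySum g E + g w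
entrySum-set g r c w v [] ()
entrySum-set g zero c w v (x ∷ E) e =
  trans (xy∙z≈xz∙y _ (entrySum g E) (g v))
    (trans (cong (_+ entrySum g E) (entrySumL-setL g c w v x e)) (xy∙z≈xz∙y _ (g w) (entrySum g E)))
entrySum-set g (suc r) c w v (x ∷ E) e =
  trans (+-assoc (sum (map g x)) _ (g v))
    (trans (cong (sum (map g x) +_) (entrySum-set g r c w v E e)) (sym (+-assoc (sum (map g x)) _ (g w))))

entrySum-evacuate : ∀ g k ks E → g 0 ≡ 0 → Yamanouchi ks → length ks ≡ k →
  (∀ r c → InShape ks (r , c) → get r c E ≡ just 0) →
  entrySum g (evacuate k ks E) ≡ entrySum g E + Σ[1…] g k
entrySum-evacuate g zero ks E g0 v e h = sym (+-identityʳ _)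
entrySum-evacuate g (suc k) ks E g0 v e h =
  trans (entrySum-evacuate g k (Δword ks) E′ g0 (yamanouchi fs) (removesCorner-length fs e) h′)
  (trans (cong (_+ Σ[1…] g k) s1) (trans (+-assoc (entrySum g E) (g (suc k)) _) refl))
  where
  fs = Δ-removesCorner′ ks v e
  dr = Δrow ks
  dc = Δcol ks
  E′ = set dr dc (suc k) E
  s1 : entrySum g E′ ≡ entrySum g E + g (suc k)
  s1 = trans (sym (+-identityʳ _))
    (trans (cong (entrySum g E′ +_) (sym g0))
      (entrySum-set g dr dc (suc k) 0 E (h dr dc (corner∈ ks _ _ _ fs))))
  h′ : ∀ r c → InShape (Δword ks) (r , c) → get r c E′ ≡ just 0
  h′ r c i = trans (get-set-≢ dr dc (suc k) E r c
    (λ q → corner∉removed ks _ _ _ fs (subst (InShape (Δword ks)) q i)))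
                   (h r c (inShape-removed ks _ _ _ fs (r , c) i))

Δ^ : ℕ → List ℕ → List ℕ
Δ^ zero ks = ks
Δ^ (suc t) ks = Δ^ t (Δword ks)

Δ^-suc : ∀ t ks → Δ^ (suc t) ks ≡ Δword (Δ^ t ks)
Δ^-suc zero ks = refl
Δ^-suc (suc t) ks = Δ^-suc t (Δword ks)

Δ^-yamanouchi : ∀ t ks n → Yamanouchi ks → length ks ≡ n → t ≤ n →
  Yamanouchi (Δ^ t ks) × length (Δ^ t ks) ≡ n ∸ t
Δ^-yamanouchi zero ks n v e le = v , e
Δ^-yamanouchi (suc t) ks (suc n) v e (s≤s le) =
  Δ^-yamanouchi t _ n (yamanouchi fs) (removesCorner-length fs e) le
  where fs = Δ-removesCorner′ ks v e

evCell≡Δ^ : ∀ k ks L → Yamanouchi ks → length ks ≡ k → 1 ≤ L → L ≤ k → evCell k ks L ≡ Δcell (Δ^ (k ∸ L) ks)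
evCell≡Δ^ zero ks L v e a b = ⊥-elim (<-irrefl refl (≤-trans a b))
evCell≡Δ^ (suc k) ks L v e a b with L ≟ suc k
... | yes refl = cong (λ t → Δcell (Δ^ t ks)) (sym (n∸n≡0 k))
... | no n = trans (evCell≡Δ^ k _ L (yamanouchi fs) (removesCorner-length fs e) a L≤k)
                   (cong (λ t → Δcell (Δ^ t ks)) (sym (m∸n≡1+m∸1+n (suc k) L (s≤s L≤k))))
  where
  fs = Δ-removesCorner′ ks v e
  L≤k = ≤-pred (≤∧≢⇒< b n)

Δ^-transfers : ∀ t ks n j → Yamanouchi ks → length ks ≡ n → suc (suc (t + j)) ≤ n →
  Transfers (cellOf ks (t + j)) (cellOf ks (suc (t + j))) (cellOf (Δ^ t ks) j) (cellOf (Δ^ t ks) (suc j))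
Δ^-transfers zero ks n j v e le = transfers-refl
Δ^-transfers (suc t) ks (suc n) j v e (s≤s le) =
  transfers-trans (Δ-transfers ks v (t + j) (≤-trans (s≤s le) (≤-reflexive (sym e))))
            (Δ^-transfers t _ n j (yamanouchi fs) (removesCorner-length fs e) le)
  where fs = Δ-removesCorner′ ks v e

evacuate-transfers : ∀ n ks → Yamanouchi ks → length ks ≡ n → ∀ i → 1 ≤ i → suc i ≤ n →
  Transfers (cellOf ks (n ∸ suc i)) (cellOf ks (suc (n ∸ suc i))) (evCell n ks i) (evCell n ks (suc i))
evacuate-transfers n ks v e i a b =
  subst₂ (λ p q → Transfers (cellOf ks p) (cellOf ks (suc p)) q (evCell n ks (suc i))) (+-identityʳ t)
    (sym l1)
    (subst (λ q → Transfers (cellOf ks (t + 0)) (cellOf ks (suc (t + 0))) (Δcell (Δword K)) q) (sym l2)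
      (transfers-trans (Δ^-transfers t ks n 0 v e c0)
        (vacated-transfers K (proj₁ ok) (≤-trans (s≤s a) (≤-reflexive (sym lenK))))))
  where
  t = n ∸ suc i
  K = Δ^ t ks
  ok = Δ^-yamanouchi t ks n v e (m∸n≤m n (suc i))
  lenK : length K ≡ suc i
  lenK = trans (proj₂ ok) (m∸[m∸n]≡n b)
  c0 : suc (suc (t + 0)) ≤ n
  c0 = subst (λ q → suc (suc q) ≤ n) (sym (+-identityʳ t))
         (subst (λ q → suc q ≤ n) (m∸n≡1+m∸1+n n i b) (∸-monoʳ-< a (≤-trans (n≤1+n i) b)))
  l1 : evCell n ks i ≡ Δcell (Δword K)
  l1 = trans (evCell≡Δ^ n ks i v e a (≤-trans (n≤1+n i) b))
             (trans (cong (λ q → Δcell (Δ^ q ks)) (m∸n≡1+m∸1+n n i b)) (cong (λ q → Δcell q) (Δ^-suc t ks)))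
  l2 : evCell n ks (suc i) ≡ Δcell K
  l2 = evCell≡Δ^ n ks (suc i) v e (s≤s z≤n) b

size-evacuate : ∀ k ks E → size (evacuate k ks E) ≡ size E
size-evacuate zero ks E = refl
size-evacuate (suc k) ks E = trans (size-evacuate k _ _) (size-set _ _ (suc k) E)

-- Charge of the evacuated recording tableau

isDescentᵇ : Cell → Cell → Bool
isDescentᵇ x y = (proj₁ x <ᵇ proj₁ y) ∧ not (proj₂ x <ᵇ proj₂ y)

isDsi-pos : ∀ S i x y → pos i S ≡ just x → pos (suc i) S ≡ just y → isDsi S i ≡ isDescentᵇ x y
isDsi-pos S i x y e1 e2 rewrite e1 | e2 = refl

descent⇒isDescentᵇ : ∀ x y → Descent x y → isDescentᵇ x y ≡ true
descent⇒isDescentᵇ (r , c) (r′ , c′) (a , b) rewrite <⇒<ᵇ≡true a | ≥⇒<ᵇ≡false b = refl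

ascent⇒¬isDescentᵇ : ∀ x y → Ascent x y → isDescentᵇ x y ≡ false
ascent⇒¬isDescentᵇ (r , c) (r′ , c′) (a , b) rewrite ≥⇒<ᵇ≡false a = refl

Σ< : (ℕ → ℕ) → ℕ → ℕ
Σ< f zero = 0
Σ< f (suc m) = f 0 + Σ< (λ t → f (suc t)) m

Σ<-cong : ∀ m f h → (∀ t → t < m → f t ≡ h t) → Σ< f m ≡ Σ< h m
Σ<-cong zero f h e = refl
Σ<-cong (suc m) f h e = cong₂ _+_ (e 0 (s≤s z≤n)) (Σ<-cong m _ _ (λ t lt → e (suc t) (s≤s lt)))

Σ<-suc : ∀ m f → Σ< f (suc m) ≡ Σ< f m + f m
Σ<-suc zero f = +-comm (f 0) 0
Σ<-suc (suc m) f = trans (cong (f 0 +_) (Σ<-suc m (λ t → f (suc t)))) (sym (+-assoc (f 0) _ _))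

Σ<-reverse : ∀ m f → Σ< f m ≡ Σ< (λ t → f (m ∸ suc t)) m
Σ<-reverse zero f = refl
Σ<-reverse (suc m) f = trans (Σ<-suc m f) (trans (cong (_+ f m) (Σ<-reverse m f)) (+-comm _ (f m)))

Σ[1…]-cong : ∀ n f h → (∀ p → f p ≡ h p) → Σ[1…] f n ≡ Σ[1…] h n
Σ[1…]-cong zero f h e = refl
Σ[1…]-cong (suc n) f h e = cong₂ _+_ (e (suc n)) (Σ[1…]-cong n f h e)

Σ[1…]-+ : ∀ n f h → Σ[1…] (λ p → f p + h p) n ≡ Σ[1…] f n + Σ[1…] h n
Σ[1…]-+ zero f h = refl
Σ[1…]-+ (suc n) f h =
  trans (cong (f (suc n) + h (suc n) +_) (Σ[1…]-+ n f h)) (interchange (f (suc n)) (h (suc n)) _ _)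

bool→ℕ : Bool → ℕ
bool→ℕ true = 1
bool→ℕ false = 0

Σ[1…]-<ᵇ : ∀ j n → Σ[1…] (λ p → bool→ℕ (j <ᵇ p)) n ≡ n ∸ j
Σ[1…]-<ᵇ j zero = sym (0∸n≡0 j)
Σ[1…]-<ᵇ j (suc n) with j ≤? n
... | yes le = trans (cong (λ b → bool→ℕ b + Σ[1…] (λ p → bool→ℕ (j <ᵇ p)) n) (lt-true (s≤s le)))
                 (trans (cong suc (Σ[1…]-<ᵇ j n)) (sym (+-∸-assoc 1 le)))
  where
  lt-true : ∀ {a b} → a < b → (a <ᵇ b) ≡ true
  lt-true {a} {b} p with a <ᵇ b | <⇒<ᵇ p
  ... | true | _ = refl
... | no nle = trans (cong (λ b → bool→ℕ b + Σ[1…] (λ p → bool→ℕ (j <ᵇ p)) n) (lt-false (≰⇒> nle)))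
                 (trans (Σ[1…]-<ᵇ j n) (trans (m≤n⇒m∸n≡0 (<⇒≤ (≰⇒> nle))) (sym (m≤n⇒m∸n≡0 (≰⇒> nle)))))
  where
  lt-false : ∀ {a b} → b < a → (a <ᵇ suc b) ≡ false
  lt-false {a} {b} p with a <ᵇ suc b in e
  ... | false = refl
  ... | true = ⊥-elim (<⇒≱ (<ᵇ⇒< a (suc b) (subst T (sym e) _)) p)

length-filter-<ᵇ-∷ : ∀ (p j : ℕ) D →
  length (filter (λ x → T? (x <ᵇ p)) (j ∷ D)) ≡ bool→ℕ (j <ᵇ p) + length (filter (λ x → T? (x <ᵇ p)) D)
length-filter-<ᵇ-∷ p j D with j <ᵇ p
... | true = refl
... | false = refl

Σ[1…]-count : ∀ n D → Σ[1…] (λ p → length (filter (λ x → T? (x <ᵇ p)) D)) n ≡ sum (map (n ∸_) D)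
Σ[1…]-count n [] = sumTo0 n
  where
  sumTo0 : ∀ n → Σ[1…] (λ p → 0) n ≡ 0
  sumTo0 zero = refl
  sumTo0 (suc n) = sumTo0 n
Σ[1…]-count n (j ∷ D) = trans (Σ[1…]-cong n _ _ (λ p → length-filter-<ᵇ-∷ p j D))
                  (trans (Σ[1…]-+ n _ _) (cong₂ _+_ (Σ[1…]-<ᵇ j n) (Σ[1…]-count n D)))

sum-filter-applyUpTo : ∀ (P : ℕ → Bool) (h : ℕ → ℕ) k m →
  sum (map h (filter (λ i → T? (P i)) (applyUpTo k m))) ≡ Σ< (λ t → if P (k t) then h (k t) else 0) m
sum-filter-applyUpTo P h k zero = refl
sum-filter-applyUpTo P h k (suc m) with P (k 0)
... | true = cong (h (k 0) +_) (sum-filter-applyUpTo P h (λ t → k (suc t)) m)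
... | false = sum-filter-applyUpTo P h (λ t → k (suc t)) m

if-+-suc : ∀ i (ys : List ℕ) t → (if nth ys (suc t) <ᵇ nth ys t then suc i + t else 0)
           ≡ (if nth ys (suc t) <ᵇ nth ys t then i + suc t else 0)
if-+-suc i ys t with nth ys (suc t) <ᵇ nth ys t
... | true = sym (+-suc i t)
... | false = refl

dslFrom-∷ : ∀ i x y rest →
  sum (dslFrom (suc i) (y ∷ rest)) ≡ Σ<
    (λ u → if nth (y ∷ rest) (suc u) <ᵇ nth (y ∷ rest) u then suc i + u else 0) (length rest) →
  sum (dslFrom i (x ∷ y ∷ rest)) ≡ Σ<
    (λ u → if nth (x ∷ y ∷ rest) (suc u) <ᵇ nth (x ∷ y ∷ rest) u then i + u else 0) (suc (length rest))
dslFrom-∷ i x y rest ih with y <ᵇ x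
... | true = trans (cong (i +_) (trans ih S≡)) (cong (_+ S′) (sym (+-identityʳ i)))
  where
  S′ = Σ< (λ t → if nth (y ∷ rest) (suc t) <ᵇ nth (y ∷ rest) t then i + suc t else 0) (length rest)
  S≡ : Σ< (λ u → if nth (y ∷ rest) (suc u) <ᵇ nth (y ∷ rest) u then suc i + u else 0) (length rest) ≡ S′
  S≡ = Σ<-cong (length rest) _ _ (λ t _ → if-+-suc i (y ∷ rest) t)
... | false = trans ih (Σ<-cong (length rest) _ _ (λ t _ → if-+-suc i (y ∷ rest) t))

sum-dslFrom : ∀ i xs →
  sum (dslFrom i xs) ≡ Σ< (λ u → if nth xs (suc u) <ᵇ nth xs u then i + u else 0) (length xs ∸ 1)
sum-dslFrom i [] = refl
sum-dslFrom i (x ∷ []) = refl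
sum-dslFrom i (x ∷ y ∷ rest) = dslFrom-∷ i x y rest (sum-dslFrom (suc i) (y ∷ rest))

blank : Tableau → Tableau
blank T = map (map (λ _ → 0)) T

entrySum-blank : ∀ g T → g 0 ≡ 0 → entrySum g (blank T) ≡ 0
entrySum-blank g [] g0 = refl
entrySum-blank g (x ∷ T) g0 = cong₂ _+_ (row x) (entrySum-blank g T g0)
  where
  row : ∀ (xs : List ℕ) → sum (map g (map (λ _ → 0) xs)) ≡ 0
  row [] = refl
  row (y ∷ ys) = cong₂ _+_ g0 (row ys)

records-transfer : ∀ {x y c d c′ d′} → Transfers c d c′ d′ → RecordsDescent x y c d → RecordsDescent x y c′ d′
records-transfer (t₁ , t₂) (r₁ , r₂) = (λ lt → t₁ (r₁ lt)) , (λ le → t₂ (r₂ le))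

isDescentᵇ-records : ∀ {x y c d} → RecordsDescent x y c d → isDescentᵇ c d ≡ (y <ᵇ x)
isDescentᵇ-records {x} {y} {c} {d} (desc , asc) with y <? x
... | yes lt = trans (descent⇒isDescentᵇ c d (desc lt)) (sym (<⇒<ᵇ≡true lt))
... | no nlt = trans (ascent⇒¬isDescentᵇ c d (asc (≮⇒≥ nlt))) (sym (≥⇒<ᵇ≡false (≮⇒≥ nlt)))

module Evacuation (xs : List ℕ) where

  n = length xs
  ks = recordingWord xs [] []
  Qxs = fill 1 ks
  E = evacuate n ks (blank Qxs)

  ks-yamanouchi : Yamanouchi ks
  ks-yamanouchi = recordingWord-yamanouchi xs [] [] rsInvariant-[]

  length-ks : length ks ≡ n
  length-ks = trans (length-recordingWord xs [] []) (+-identityʳ n)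

  blank-inside : ∀ r c → InShape ks (r , c) → c < rowLength r (blank Qxs)
  blank-inside r c i = subst (c <_)
    (sym (trans (rowLength-map (λ _ → 0) r Qxs) (rowLength-fill 1 ks ks-yamanouchi r))) i

  blank-zero : ∀ r c → InShape ks (r , c) → get r c (blank Qxs) ≡ just 0
  blank-zero r c i with get-<⇒just r c Qxs (subst (c <_) (sym (rowLength-fill 1 ks ks-yamanouchi r)) i)
  ... | v , ev = trans (get-map (λ _ → 0) r c Qxs) (cong (Maybe.map (λ _ → 0)) ev)

  blank-values : ∀ r c v → get r c (blank Qxs) ≡ just v → v ≡ 0
  blank-values r c v e with get r c Qxs | get-map (λ _ → 0) r c Qxs
  ... | just w | q = just-injective (trans (sym e) q)
  ... | nothing | q with trans (sym q) e
  ...   | ()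

  ev-Qxs : ev Qxs ≡ E
  ev-Qxs = trans (cong (λ s → evLoop s Qxs (blank Qxs)) (trans (size-fill 1 ks) length-ks))
                 (evLoop≡evacuate n 1 ks (blank Qxs) ks-yamanouchi length-ks)

  size-E : size E ≡ n
  size-E = trans (size-evacuate n ks (blank Qxs))
    (trans (size-map (λ _ → 0) Qxs) (trans (size-fill 1 ks) length-ks))

  pos-E : ∀ p → 1 ≤ p → p ≤ n → pos p E ≡ just (evCell n ks p)
  pos-E p a b = pos-unique p E _ _
    (evacuate-evCell n ks (blank Qxs) ks-yamanouchi length-ks blank-inside p a b) unique
    where
    unique : ∀ r' c' → get r' c' E ≡ just p → (r' , c') ≡ evCell n ks p
    unique r' c' g with evacuate-cases n ks (blank Qxs) r' c'
    ... | inj₁ (L , _ , _ , c′ , g′) with trans (sym g) g′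
    ...   | refl = c′
    unique r' c' g | inj₂ g′ = ⊥-elim (<-irrefl (sym (blank-values r' c' p (trans (sym g′) g))) a)

  isDsi-E : ∀ i → 1 ≤ i → suc i ≤ n → isDsi E i ≡ (nth xs (suc (n ∸ suc i)) <ᵇ nth xs (n ∸ suc i))
  isDsi-E i a b =
    trans (isDsi-pos E i _ _ (pos-E i a (≤-trans (n≤1+n i) b)) (pos-E (suc i) (s≤s z≤n) b))
          (isDescentᵇ-records (records-transfer (evacuate-transfers n ks ks-yamanouchi length-ks i a b)
            (recording-transfers xs [] [] rsInvariant-[] (n ∸ suc i)
              (subst (_< n) (m∸n≡1+m∸1+n n i b) (∸-monoʳ-< a (≤-trans (n≤1+n i) b))))))

  ctEntry : ℕ → ℕ
  ctEntry p = length (filter (λ j → T? (j <ᵇ p)) (Dsi E))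

  ctEntry-0 : ctEntry 0 ≡ 0
  ctEntry-0 = none (Dsi E)
    where
    none : ∀ D → length (filter (λ j → T? (j <ᵇ 0)) D) ≡ 0
    none [] = refl
    none (j ∷ D) = none D

  cc-E : cc E ≡ sum (map (n ∸_) (Dsi E))
  cc-E = begin
    cc E
      ≡⟨ entrySum-evacuate ctEntry n ks (blank Qxs) ctEntry-0 ks-yamanouchi length-ks blank-zero ⟩
    entrySum ctEntry (blank Qxs) + Σ[1…] ctEntry n
      ≡⟨ cong (_+ Σ[1…] ctEntry n) (entrySum-blank ctEntry Qxs ctEntry-0) ⟩
    Σ[1…] ctEntry n
      ≡⟨ Σ[1…]-count n (Dsi E) ⟩
    sum (map (n ∸_) (Dsi E))
      ∎

  m = n ∸ 1

  n≡1+m : ∀ {u} → u < m → n ≡ suc m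
  n≡1+m {u} lt with n | lt
  ... | zero | ()
  ... | suc _ | _ = refl

  Dsi-E : Dsi E ≡ filter (λ i → T? (isDsi E i)) (applyUpTo suc m)
  Dsi-E = trans (cong (λ s → filter (λ i → T? (isDsi E i)) (map suc (upTo (s ∸ 1)))) size-E)
                (cong (filter (λ i → T? (isDsi E i))) (List.map-applyUpTo (λ x → x) suc m))

  descentAt : ℕ → ℕ
  descentAt t = if nth xs (suc (n ∸ suc (suc t))) <ᵇ nth xs (n ∸ suc (suc t)) then n ∸ suc t else 0

  Dsi-term : ∀ t → t < m → (if isDsi E (suc t) then n ∸ suc t else 0) ≡ descentAt t
  Dsi-term t lt rewrite isDsi-E (suc t) (s≤s z≤n) (subst (suc (suc t) ≤_) (sym (n≡1+m lt)) (s≤s lt)) = refl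

  Dsl-term : ∀ u → u < m → descentAt (m ∸ suc u) ≡ (if nth xs (suc u) <ᵇ nth xs u then suc u else 0)
  Dsl-term u lt rewrite trans (cong (λ q → q ∸ suc (suc (m ∸ suc u))) (n≡1+m lt)) (m∸[1+m∸[1+n]]≡n m u lt)
                      | trans (cong (λ q → q ∸ suc (m ∸ suc u)) (n≡1+m lt)) (m∸[m∸n]≡n lt) = refl

  Σ-Dsi-E : sum (map (n ∸_) (Dsi E)) ≡ sum (dslFrom 1 xs)
  Σ-Dsi-E = begin
    sum (map (n ∸_) (Dsi E))
      ≡⟨ cong (λ D → sum (map (n ∸_) D)) Dsi-E ⟩
    sum (map (n ∸_) (filter (λ i → T? (isDsi E i)) (applyUpTo suc m)))
      ≡⟨ sum-filter-applyUpTo (isDsi E) (n ∸_) suc m ⟩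
    Σ< (λ t → if isDsi E (suc t) then n ∸ suc t else 0) m
      ≡⟨ Σ<-cong m _ _ Dsi-term ⟩
    Σ< descentAt m
      ≡⟨ Σ<-reverse m descentAt ⟩
    Σ< (λ t → descentAt (m ∸ suc t)) m
      ≡⟨ Σ<-cong m _ _ Dsl-term ⟩
    Σ< (λ u → if nth xs (suc u) <ᵇ nth xs u then suc u else 0) m
      ≡⟨ sum-dslFrom 1 xs ⟨
    sum (dslFrom 1 xs)
      ∎

cc-ev-RS : ∀ xs → cc (ev (proj₂ (RS xs))) ≡ sum (dslFrom 1 xs)
cc-ev-RS xs = begin
  cc (ev (proj₂ (RS xs)))    ≡⟨ cong (λ T → cc (ev T)) (RS-recording xs) ⟩
  cc (ev Qxs)                ≡⟨ cong cc ev-Qxs ⟩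
  cc E                       ≡⟨ cc-E ⟩
  sum (map (n ∸_) (Dsi E))   ≡⟨ Σ-Dsi-E ⟩
  sum (dslFrom 1 xs)         ∎
  where open Evacuation xs

tabulate-snoc : ∀ {A : Set} n (f : Fin (suc n) → A) →
  tabulate f ≡ tabulate (λ i → f (inject₁ i)) ++ f (fromℕ n) ∷ []
tabulate-snoc zero f = refl
tabulate-snoc (suc n) f = cong (f Fin.zero ∷_) (tabulate-snoc n (λ i → f (Fin.suc i)))

dslFrom-snoc-max : ∀ i ys v → All (_≤ v) ys → dslFrom i (ys ++ v ∷ []) ≡ dslFrom i ys
dslFrom-snoc-max i [] v _ = refl
dslFrom-snoc-max i (y ∷ []) v (p ∷ _) rewrite ≥⇒<ᵇ≡false p = refl
dslFrom-snoc-max i (y ∷ y2 ∷ rest) v (p ∷ ps) =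
  cong (λ L → if y2 <ᵇ y then i ∷ L else L) (dslFrom-snoc-max (suc i) (y2 ∷ rest) v ps)

word-tabulate : ∀ {n} (w : Permutation′ n) → word w ≡ tabulate (λ i → suc (toℕ (w ⟨$⟩ʳ i)))
word-tabulate w = List.map-tabulate (λ i → i) (λ i → suc (toℕ (w ⟨$⟩ʳ i)))

word-bounded : ∀ {n} (w : Permutation′ n) → All (_≤ suc n) (word w)
word-bounded {n} w = go (allFin n)
  where
  go : ∀ (L : List (Fin n)) → All (_≤ suc n) (map (λ i → suc (toℕ (w ⟨$⟩ʳ i))) L)
  go [] = []
  go (x ∷ L) = s≤s (<⇒≤ (toℕ<n (w ⟨$⟩ʳ x))) ∷ go L

word-fixing-last : ∀ {n} (w : Permutation′ n) (w₊ : Permutation′ (suc n)) →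
  (∀ i → w₊ ⟨$⟩ʳ inject₁ i ≡ inject₁ (w ⟨$⟩ʳ i)) → w₊ ⟨$⟩ʳ fromℕ n ≡ fromℕ n →
  word w₊ ≡ word w ++ suc n ∷ []
word-fixing-last {n} w w₊ agree fixes =
  trans (word-tabulate w₊) (trans (tabulate-snoc n (λ i → suc (toℕ (w₊ ⟨$⟩ʳ i))))
    (cong₂ (λ A b → A ++ b ∷ [])
      (trans (List.tabulate-cong (λ i → cong suc (trans (cong toℕ (agree i)) (toℕ-inject₁ (w ⟨$⟩ʳ i)))))
        (sym (word-tabulate w)))
      (cong suc (trans (cong toℕ fixes) (toℕ-fromℕ n)))))

proposition1p13 : (n : ℕ) (w : Permutation′ n) →
    cc (Q̃ w) ≡ sum (Dsl w)
    × ((w₊ : Permutation′ (suc n)) →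
         (∀ i → w₊ ⟨$⟩ʳ inject₁ i ≡ inject₁ (w ⟨$⟩ʳ i)) →
         w₊ ⟨$⟩ʳ fromℕ n ≡ fromℕ n →
         cc (Q̃ w₊) ≡ cc (Q̃ w))
proposition1p13 n w = cc-ev-RS (word w) , λ w₊ agree fixes → begin
  cc (Q̃ w₊)                               ≡⟨ cc-ev-RS (word w₊) ⟩
  sum (dslFrom 1 (word w₊))               ≡⟨ cong (λ u → sum (dslFrom 1 u)) (word-fixing-last w w₊ agree fixes) ⟩
  sum (dslFrom 1 (word w ++ suc n ∷ []))  ≡⟨ cong sum (dslFrom-snoc-max 1 (word w) (suc n) (word-bounded w)) ⟩
  sum (dslFrom 1 (word w))                ≡⟨ cc-ev-RS (word w) ⟨
  cc (Q̃ w)                                ∎
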